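{- For all $n\ge1$, $a_{\{0101,0120\}}(n)=a_{\{101,120\}}(n)=|S_n(231,4123)|$. Moreover, with $a(n)=a_{\{0101,0120\}}(n)$ for $n\ge1$ and $a(0)=1$, \[\sum_{n\ge0}a(n)x^n=\frac{(1-x)^3}{1-4x+5x^2-3x^3}.\]
   Context: An ascent in an integer sequence $s_1\cdots s_m$ is an index $j$ with $s_j<s_{j+1}$; $\mathrm{asc}(s)$ is the number of ascents. An ascent sequence is a sequence $x_1\cdots x_n$ of nonnegative integers with $x_1=0$ and $x_i\le 1+\mathrm{asc}(x_1\cdots x_{i-1})$ for $i\ge2$. For a sequence $w$, $\mathrm{red}(w)$ replaces the $i$-th smallest distinct letter of $w$ by $i-1$. A pattern (e.g. $0101$, meaning the sequence $(0,1,0,1)$, or $101$) is a sequence equal to its reduction. A sequence $x$ contains pattern $p=p_1\cdots p_k$ if there are indices $i_1<\cdots<i_k$ with $\mathrm{red}(x_{i_1}\cdots x_{i_k})=p$; otherwise it avoids $p$. For a set of patterns $P$, $\mathcal A_n(P)$ is the set of ascent sequences of length $n$ avoiding every pattern in $P$, and $a_P(n)=|\mathcal A_n(P)|$. $S_n(231,4123)$ denotes the set of permutations of $\{1,\dots,n\}$ avoiding both classical permutation patterns $231$ and $4123$. -}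

module Defs where

open import Data.Bool using (Bool; true; false; T; _∧_; not; if_then_else_)
open import Data.Nat as ℕ using (ℕ; zero; suc; _∸_; _≡ᵇ_; _<ᵇ_; _≤ᵇ_)
open import Data.Integer as ℤ using (ℤ; +_; -[1+_])
open import Data.Bool.ListAction using (any; all)
open import Data.List using (List; []; _∷_; _++_; [_]; length; map; filter; foldr; upTo; deduplicateᵇ; applyUpTo)
open import Data.Product using (Σ; _,_)
open import Data.Fin using (Fin)
open import Function.Bundles using (_↔_)

eqList : List ℕ → List ℕ → Bool
eqList [] [] = true
eqList [] (_ ∷ _) = false
eqList (_ ∷ _) [] = false
eqList (a ∷ as) (b ∷ bs) = (a ≡ᵇ b) ∧ eqList as bs

asc : List ℕ → ℕ
asc [] = 0
asc (a ∷ []) = 0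
asc (a ∷ b ∷ r) = (if a <ᵇ b then 1 else 0) ℕ.+ asc (b ∷ r)

ascentCond : List ℕ → List ℕ → Bool
ascentCond pre [] = true
ascentCond pre (y ∷ ys) = (y ≤ᵇ suc (asc pre)) ∧ ascentCond (pre ++ [ y ]) ys

isAscentSeq : List ℕ → Bool
isAscentSeq [] = false
isAscentSeq (x ∷ xs) = (x ≡ᵇ 0) ∧ ascentCond (x ∷ []) xs

red : List ℕ → List ℕ
red w = map (λ a → length (deduplicateᵇ _≡ᵇ_ (filter (λ b → b ℕ.<? a) w))) w

subseqs : List ℕ → List (List ℕ)
subseqs [] = [] ∷ []
subseqs (x ∷ xs) = subseqs xs ++ map (x ∷_) (subseqs xs)

-- x contains p: some subsequence s of x has red(s) = red(p)
-- (for a pattern p we have red(p) = p; for classical permutation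
--  patterns this is order-isomorphism, the usual containment).
contains : List ℕ → List ℕ → Bool
contains p x = any (λ s → eqList (red s) (red p)) (subseqs x)

avoidsAll : List (List ℕ) → List ℕ → Bool
avoidsAll P x = all (λ p → not (contains p x)) P

AscAvoid : List (List ℕ) → ℕ → Set
AscAvoid P n = Σ (List ℕ) λ x →
  T ((length x ≡ᵇ n) ∧ isAscentSeq x ∧ avoidsAll P x)

isPerm : ℕ → List ℕ → Bool
isPerm n x = (length x ≡ᵇ n) ∧ all (λ k → any (λ y → y ≡ᵇ k) x) (applyUpTo suc n)

PermAvoid : List (List ℕ) → ℕ → Set
PermAvoid P n = Σ (List ℕ) λ x → T (isPerm n x ∧ avoidsAll P x)

HasCard : Set → ℕ → Set
HasCard A m = A ↔ Fin m

Series : Set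
Series = ℕ → ℤ

_*ₛ_ : Series → Series → Series
(f *ₛ g) n = foldr ℤ._+_ (+ 0) (map (λ k → f k ℤ.* g (n ∸ k)) (upTo (suc n)))

poly : List ℤ → Series
poly [] n = + 0
poly (c ∷ cs) zero = c
poly (c ∷ cs) (suc n) = poly cs n

series : (ℕ → ℕ) → Series
series a n = + (a n)

oneMinusX : Series
oneMinusX = poly (+ 1 ∷ -[1+ 0 ] ∷ [])

numerator : Series
numerator = (oneMinusX *ₛ oneMinusX) *ₛ oneMinusX

denominator : Series
denominator = poly (+ 1 ∷ -[1+ 3 ] ∷ + 5 ∷ -[1+ 2 ] ∷ [])

{-# OPTIONS --safe #-}
-- For each of the three families, the objects of size n + 1 are in bijection with level n of one generating
-- tree with labels A, B, C and succession rule A → AC, B → BA, C → CBC.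
--
-- Ascent sequences grow by appending a letter.  Avoiding {101, 120} or {0101, 0120} forces asc x to equal the
-- maximum M of x and every letter to be preceded by all smaller letters; the letters that may then be appended
-- are the last letter again, the new maximum M + 1 and, in some states, M − 1.  Both pattern pairs allow exactly
-- the same extensions, so the two classes coincide.
--
-- Permutations grow by inserting the new maximum at an active site, a cut u | w with u entirely below w and w
-- free of 123 (otherwise a 231 or a 4123 appears).  Three kinds of block decomposition record where the active
-- sites are, and each kind reproduces the succession rule.
--
-- The transfer matrix of the rule has characteristic polynomial t³ − 4t² + 5t − 3, which yields the recurrence
-- behind the generating function (1 − x)³ / (1 − 4x + 5x² − 3x³).

module Submission where

open import Defs
open import Data.Nat using (ℕ; _≤_)
open import Data.List using (List; []; _∷_)
open import Data.Product using (Σ; _×_)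
open import Relation.Binary.PropositionalEquality using (_≡_)

open import Data.Bool using (Bool; true; false; T; _∧_; not; if_then_else_)
open import Data.Bool.Properties using (T-∧; T-irrelevant; ∧-assoc; ∧-identityʳ)
open import Data.Bool.ListAction using (any; all)
open import Data.Empty using (⊥; ⊥-elim)
open import Data.Fin as Fin using (Fin)
open import Data.Integer as ℤ using (ℤ; +_)
import Data.Integer.Properties as ℤ
import Data.Integer.Tactic.RingSolver as ℤ-Solver
open import Data.List
  using (_++_; [_]; length; map; filter; deduplicate; deduplicateᵇ; concatMap; foldr; applyUpTo; lookup; initLast; _∷ʳ′_)
open import Data.List.Properties
  using (++-assoc; ++-identityʳ; ++-identityʳ-unique; ++-conicalʳ; ∷-injective; ∷ʳ-injective; ∷ʳ-injectiveˡ; ∷ʳ-injectiveʳ;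
         length-++-sucʳ; length-map; map-++; map-∘; map-cong; filter-accept; filter-reject; filter-notAll)
open import Data.List.Membership.Propositional using (_∈_; _∉_; find; lose)
open import Data.List.Membership.Propositional.Properties
  using (∈-++⁺ˡ; ∈-++⁺ʳ; ∈-++⁻; ∈-map⁺; ∈-map⁻; ∈-filter⁺; ∈-∃++; ∈-lookup; ∈-concatMap⁺; ∈-concatMap⁻;
         ∈-applyUpTo⁺; ∈-applyUpTo⁻)
import Data.List.Membership.Setoid.Properties as SetoidMembership
open import Data.List.Relation.Unary.All using (All; []; _∷_)
import Data.List.Relation.Unary.All as All
open import Data.List.Relation.Unary.All.Properties using (all⁺; all⁻)
open import Data.List.Relation.Unary.AllPairs using ([]; _∷_)
open import Data.List.Relation.Unary.Any using (here; there; index)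
import Data.List.Relation.Unary.Any as Any
open import Data.List.Relation.Unary.Any.Properties using (any⁺; any⁻; lookup-index)
open import Data.List.Relation.Unary.Unique.Propositional using (Unique)
open import Data.List.Relation.Unary.Unique.Propositional.Properties using () renaming (++⁺ to Unique-++⁺)
open import Data.List.Relation.Binary.Disjoint.Propositional using (Disjoint)
open import Data.List.Relation.Binary.Sublist.Propositional using (_⊆_; []; _∷_; _∷ʳ_; ⊆-refl; ⊆-trans; minimum; from∈)
import Data.List.Relation.Binary.Sublist.Propositional as Sublist
open import Data.List.Relation.Binary.Sublist.Propositional.Properties using (++⁺; ++⁺ˡ; ++⁺ʳ; ∷ˡ⁻)
open import Data.Nat using (zero; suc; _+_; _*_; _∸_; _<_; _<?_; _≤?_; _<ᵇ_; _≤ᵇ_; _≡ᵇ_; z≤n; s≤s)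
open import Data.Nat.ListAction using (sum)
open import Data.Nat.ListAction.Properties using (sum-++)
open import Data.Nat.Properties
  using (+-assoc; +-comm; +-suc; +-identityʳ; +-monoʳ-≤; +-∸-assoc; m+n∸n≡m; n∸n≡0; m+n≤o⇒m≤o∸n; suc-injective;
         ≤-refl; ≤-trans; ≤-pred; ≤-antisym; <-trans; <-≤-trans; <-cmp; n≮n; n≮0; <⇒≢; <⇒≱; <⇒≤; ≰⇒>;
         n≤1+n; n<1+n;
         m≤n⇒m≤1+n; m≤n⇒m<n∨m≡n; ≡ᵇ⇒≡; ≡⇒≡ᵇ; ≤ᵇ⇒≤; ≤⇒≤ᵇ; <ᵇ⇒<; <⇒<ᵇ)
import Data.Nat.Tactic.RingSolver as ℕ-Solver
open import Data.Product using (∃; ∃₂; _,_; proj₁; proj₂)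
open import Data.Sum using (_⊎_; inj₁; inj₂)
open import Data.Unit using (⊤; tt)
open import Function using (_∘_; Equivalence)
open import Function.Bundles using (_↔_; mk↔ₛ′)
open import Level using (0ℓ)
open import Relation.Binary using (Rel; tri<; tri≈; tri>; _Preserves_⟶_) renaming (Decidable to Decidable₂)
open import Relation.Binary.PropositionalEquality using (_≢_; refl; sym; trans; cong; cong₂; subst; setoid; module ≡-Reasoning)
open import Relation.Nullary using (¬_; yes; no; ¬?)
open import Relation.Unary using (Pred; Decidable)

-- Pattern occurrences

T-∧⁻ : ∀ {a b} → T (a ∧ b) → T a × T b
T-∧⁻ = Equivalence.to T-∧

T-∧⁺ : ∀ {a b} → T a → T b → T (a ∧ b)
T-∧⁺ ta tb = Equivalence.from T-∧ (ta , tb)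

T-not⁻ : ∀ {a} → T (not a) → ¬ T a
T-not⁻ {false} _ ()

T-not⁺ : ∀ {a} → ¬ T a → T (not a)
T-not⁺ {true} ¬t = ¬t tt
T-not⁺ {false} _ = tt

eqList⇒≡ : ∀ a b → T (eqList a b) → a ≡ b
eqList⇒≡ [] [] _ = refl
eqList⇒≡ (x ∷ a) (y ∷ b) t with T-∧⁻ {x ≡ᵇ y} t
... | x≡y , a≡b = cong₂ _∷_ (≡ᵇ⇒≡ x y x≡y) (eqList⇒≡ a b a≡b)

eqList-refl : ∀ a → T (eqList a a)
eqList-refl [] = tt
eqList-refl (x ∷ a) = T-∧⁺ {x ≡ᵇ x} (≡⇒≡ᵇ x x refl) (eqList-refl a)

∈-subseqs⁺ : ∀ {s x} → s ⊆ x → s ∈ subseqs x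
∈-subseqs⁺ [] = here refl
∈-subseqs⁺ {x = y ∷ x} (.y ∷ʳ s⊆x) = ∈-++⁺ˡ (∈-subseqs⁺ s⊆x)
∈-subseqs⁺ {x = y ∷ x} (refl ∷ s⊆x) = ∈-++⁺ʳ (subseqs x) (∈-map⁺ (y ∷_) (∈-subseqs⁺ s⊆x))

∈-subseqs⁻ : ∀ {s} x → s ∈ subseqs x → s ⊆ x
∈-subseqs⁻ [] (here refl) = []
∈-subseqs⁻ (y ∷ x) s∈ with ∈-++⁻ (subseqs x) s∈
... | inj₁ s∈₁ = y ∷ʳ ∈-subseqs⁻ x s∈₁
... | inj₂ s∈₂ with ∈-map⁻ (y ∷_) s∈₂
... | t , t∈ , refl = refl ∷ ∈-subseqs⁻ x t∈

Occurs : List ℕ → List ℕ → Set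
Occurs p x = ∃ λ s → s ⊆ x × red s ≡ p

Occurs-⊆ : ∀ {p x y} → x ⊆ y → Occurs p x → Occurs p y
Occurs-⊆ x⊆y (s , s⊆x , e) = s , ⊆-trans s⊆x x⊆y , e

contains⇒Occurs : ∀ p x → T (contains p x) → Occurs (red p) x
contains⇒Occurs p x t with find (any⁻ _ (subseqs x) t)
... | s , s∈ , e = s , ∈-subseqs⁻ x s∈ , eqList⇒≡ (red s) (red p) e

Occurs⇒contains : ∀ p x → Occurs (red p) x → T (contains p x)
Occurs⇒contains p x (s , s⊆x , e) =
  any⁺ _ (lose (∈-subseqs⁺ s⊆x) (subst (λ r → T (eqList (red s) r)) e (eqList-refl (red s))))

Avoids : List (List ℕ) → List ℕ → Set
Avoids P x = All (λ p → ¬ Occurs (red p) x) P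

avoidsAll⇒Avoids : ∀ P x → T (avoidsAll P x) → Avoids P x
avoidsAll⇒Avoids P x t = All.map (λ {p} t → T-not⁻ t ∘ Occurs⇒contains p x) (all⁺ _ P t)

Avoids⇒avoidsAll : ∀ P x → Avoids P x → T (avoidsAll P x)
Avoids⇒avoidsAll P x av = all⁻ _ (All.map (λ {p} ¬o → T-not⁺ (¬o ∘ contains⇒Occurs p x)) av)

Avoids-⊆ : ∀ {P x y} → x ⊆ y → Avoids P y → Avoids P x
Avoids-⊆ x⊆y = All.map (λ ¬o → ¬o ∘ Occurs-⊆ x⊆y)

¬Occurs-singleton : ∀ {p₀ p₁ ps y} → ¬ Occurs (p₀ ∷ p₁ ∷ ps) [ y ]
¬Occurs-singleton (_ , _ ∷ʳ [] , ())
¬Occurs-singleton (_ , refl ∷ [] , ())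

-- Reduction and ranks

module _ {A : Set} {P Q : Pred A 0ℓ} (P? : Decidable P) (Q? : Decidable Q) where

  filter-comm : ∀ xs → filter P? (filter Q? xs) ≡ filter Q? (filter P? xs)
  filter-comm [] = refl
  filter-comm (x ∷ xs) with P? x | Q? x
  ... | yes px | yes qx rewrite filter-accept P? {xs = filter Q? xs} px | filter-accept Q? {xs = filter P? xs} qx =
    cong (x ∷_) (filter-comm xs)
  ... | yes px | no ¬qx rewrite filter-reject Q? {xs = filter P? xs} ¬qx = filter-comm xs
  ... | no ¬px | yes qx rewrite filter-reject P? {xs = filter Q? xs} ¬px = filter-comm xs
  ... | no ¬px | no ¬qx = filter-comm xs

  filter-absorb : (∀ {x} → P x → Q x) → ∀ xs → filter P? (filter Q? xs) ≡ filter P? xs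
  filter-absorb P⇒Q [] = refl
  filter-absorb P⇒Q (x ∷ xs) with P? x | Q? x
  ... | yes px | yes qx rewrite filter-accept P? {xs = filter Q? xs} px = cong (x ∷_) (filter-absorb P⇒Q xs)
  ... | yes px | no ¬qx = ⊥-elim (¬qx (P⇒Q px))
  ... | no ¬px | yes qx rewrite filter-reject P? {xs = filter Q? xs} ¬px = filter-absorb P⇒Q xs
  ... | no ¬px | no ¬qx = filter-absorb P⇒Q xs

module _ {A : Set} {R : Rel A 0ℓ} (R? : Decidable₂ R) {P : Pred A 0ℓ} (P? : Decidable P)
         (P-resp : ∀ {x y} → R x y → P y → P x) where

  deduplicate-filter : ∀ xs → deduplicate R? (filter P? xs) ≡ filter P? (deduplicate R? xs)
  deduplicate-filter [] = refl
  deduplicate-filter (x ∷ xs) with P? x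
  ... | yes px =
    cong (x ∷_) (trans (cong (filter (¬? ∘ R? x)) (deduplicate-filter xs))
                       (filter-comm (¬? ∘ R? x) P? (deduplicate R? xs)))
  ... | no ¬px = trans (deduplicate-filter xs)
    (sym (filter-absorb P? (¬? ∘ R? x) (λ py rxy → ¬px (P-resp rxy py)) (deduplicate R? xs)))

dedup : List ℕ → List ℕ
dedup = deduplicateᵇ _≡ᵇ_

∈-dedup⁺ : ∀ {a s} → a ∈ s → a ∈ dedup s
∈-dedup⁺ = SetoidMembership.∈-deduplicate⁺ (setoid ℕ) _ (λ r a≡x → trans a≡x (sym (≡ᵇ⇒≡ _ _ r)))

-- red s replaces each letter a of s by rank s a (definitionally, red s = map (rank s) s).
rank : List ℕ → ℕ → ℕ
rank s a = length (dedup (filter (_<? a) s))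

rank-via-dedup : ∀ s a → rank s a ≡ length (filter (_<? a) (dedup s))
rank-via-dedup s a = cong length (deduplicate-filter _ (_<? a) (λ {x} {y} r y<a → subst (_< a) (sym (≡ᵇ⇒≡ x y r)) y<a) s)

rank-strict : ∀ s {y z} → y ∈ s → y < z → rank s y < rank s z
rank-strict s {y} {z} y∈s y<z rewrite rank-via-dedup s y | rank-via-dedup s z
  | sym (filter-absorb (_<? y) (_<? z) (λ x<y → <-trans x<y y<z) (dedup s)) =
  filter-notAll (_<? y) (filter (_<? z) (dedup s)) (lose (∈-filter⁺ (_<? z) (∈-dedup⁺ y∈s) y<z) (n≮n y))

rank-reflects-< : ∀ s {y z} → z ∈ s → rank s y < rank s z → y < z
rank-reflects-< s {y} {z} z∈s r< with <-cmp y z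
... | tri< y<z _ _ = y<z
... | tri≈ _ refl _ = ⊥-elim (n≮n _ r<)
... | tri> _ _ z<y = ⊥-elim (<⇒≱ r< (<⇒≤ (rank-strict s z∈s z<y)))

rank-injective : ∀ s {y z} → y ∈ s → z ∈ s → rank s y ≡ rank s z → y ≡ z
rank-injective s {y} {z} y∈s z∈s r≡ with <-cmp y z
... | tri< y<z _ _ = ⊥-elim (<⇒≢ (rank-strict s y∈s y<z) r≡)
... | tri≈ _ y≡z _ = y≡z
... | tri> _ _ z<y = ⊥-elim (<⇒≢ (rank-strict s z∈s z<y) (sym r≡))

rank<rank⇒< : ∀ s {y z i j} → z ∈ s → rank s y ≡ i → rank s z ≡ j → i < j → y < z
rank<rank⇒< s z∈s refl refl = rank-reflects-< s z∈s

rank≡rank⇒≡ : ∀ s {y z i} → y ∈ s → z ∈ s → rank s y ≡ i → rank s z ≡ i → y ≡ z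
rank≡rank⇒≡ s y∈s z∈s ry rz = rank-injective s y∈s z∈s (trans ry (sym rz))

private
  ∷-injective₃ : ∀ {a b c a′ b′ c′ : ℕ} → _≡_ {A = List ℕ} (a ∷ b ∷ c ∷ []) (a′ ∷ b′ ∷ c′ ∷ []) →
    a ≡ a′ × b ≡ b′ × c ≡ c′
  ∷-injective₃ refl = refl , refl , refl

  ∷-injective₄ : ∀ {a b c d a′ b′ c′ d′ : ℕ} →
    _≡_ {A = List ℕ} (a ∷ b ∷ c ∷ d ∷ []) (a′ ∷ b′ ∷ c′ ∷ d′ ∷ []) → a ≡ a′ × b ≡ b′ × c ≡ c′ × d ≡ d′
  ∷-injective₄ refl = refl , refl , refl , refl

  1st : ∀ {a : ℕ} {l : List ℕ} → a ∈ a ∷ l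
  1st = here refl
  2nd : ∀ {a b : ℕ} {l : List ℕ} → b ∈ a ∷ b ∷ l
  2nd = there 1st
  3rd : ∀ {a b c : ℕ} {l : List ℕ} → c ∈ a ∷ b ∷ c ∷ l
  3rd = there 2nd
  4th : ∀ {a b c d : ℕ} {l : List ℕ} → d ∈ a ∷ b ∷ c ∷ d ∷ l
  4th = there 3rd

  0<1 : 0 < 1
  0<1 = s≤s z≤n
  1<2 : 1 < 2
  1<2 = s≤s 0<1
  2<3 : 2 < 3
  2<3 = s≤s 1<2

red≡101⇒ : ∀ a b c → red (a ∷ b ∷ c ∷ []) ≡ 1 ∷ 0 ∷ 1 ∷ [] → b < a × c ≡ a
red≡101⇒ a b c e with ∷-injective₃ e
... | ra , rb , rc = rank<rank⇒< s 1st rb ra 0<1 , rank≡rank⇒≡ s 3rd 1st rc ra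
  where s = a ∷ b ∷ c ∷ []

red≡120⇒ : ∀ a b c → red (a ∷ b ∷ c ∷ []) ≡ 1 ∷ 2 ∷ 0 ∷ [] → c < a × a < b
red≡120⇒ a b c e with ∷-injective₃ e
... | ra , rb , rc = rank<rank⇒< s 1st rc ra 0<1 , rank<rank⇒< s 2nd ra rb 1<2
  where s = a ∷ b ∷ c ∷ []

red≡0101⇒ : ∀ a b c d → red (a ∷ b ∷ c ∷ d ∷ []) ≡ 0 ∷ 1 ∷ 0 ∷ 1 ∷ [] → a < b × c ≡ a × d ≡ b
red≡0101⇒ a b c d e with ∷-injective₄ e
... | ra , rb , rc , rd = rank<rank⇒< s 2nd ra rb 0<1 , rank≡rank⇒≡ s 3rd 1st rc ra , rank≡rank⇒≡ s 4th 2nd rd rb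
  where s = a ∷ b ∷ c ∷ d ∷ []

red≡0120⇒ : ∀ a b c d → red (a ∷ b ∷ c ∷ d ∷ []) ≡ 0 ∷ 1 ∷ 2 ∷ 0 ∷ [] → a < b × b < c × d ≡ a
red≡0120⇒ a b c d e with ∷-injective₄ e
... | ra , rb , rc , rd = rank<rank⇒< s 2nd ra rb 0<1 , rank<rank⇒< s 3rd rb rc 1<2 , rank≡rank⇒≡ s 4th 1st rd ra
  where s = a ∷ b ∷ c ∷ d ∷ []

red≡3012⇒ : ∀ a b c d → red (a ∷ b ∷ c ∷ d ∷ []) ≡ 3 ∷ 0 ∷ 1 ∷ 2 ∷ [] → b < c × c < d × d < a
red≡3012⇒ a b c d e with ∷-injective₄ e
... | ra , rb , rc , rd = rank<rank⇒< s 3rd rb rc 0<1 , rank<rank⇒< s 4th rc rd 1<2 , rank<rank⇒< s 1st rd ra 2<3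
  where s = a ∷ b ∷ c ∷ d ∷ []

length-red : ∀ s → length (red s) ≡ length s
length-red s = length-map (rank s) s

module _ {A B : Set} (f : A → B) {P : Pred B 0ℓ} {Q : Pred A 0ℓ} (P? : Decidable P) (Q? : Decidable Q)
         (P∘f⇔Q : ∀ a → (P (f a) → Q a) × (Q a → P (f a))) where

  filter-map : ∀ xs → filter P? (map f xs) ≡ map f (filter Q? xs)
  filter-map [] = refl
  filter-map (x ∷ xs) with Q? x
  ... | yes qx rewrite filter-accept P? {xs = map f xs} (proj₂ (P∘f⇔Q x) qx) = cong (f x ∷_) (filter-map xs)
  ... | no ¬qx rewrite filter-reject P? {xs = map f xs} (¬qx ∘ proj₁ (P∘f⇔Q x)) = filter-map xs

module _ {f : ℕ → ℕ} (f-mono : f Preserves _<_ ⟶ _<_) where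

  mono-reflects-< : ∀ {i j} → f i < f j → i < j
  mono-reflects-< {i} {j} fi<fj with <-cmp i j
  ... | tri< i<j _ _ = i<j
  ... | tri≈ _ refl _ = ⊥-elim (n≮n _ fi<fj)
  ... | tri> _ _ j<i = ⊥-elim (n≮n _ (<-trans fi<fj (f-mono j<i)))

  mono-injective : ∀ {i j} → f i ≡ f j → i ≡ j
  mono-injective {i} {j} fi≡fj with <-cmp i j
  ... | tri< i<j _ _ = ⊥-elim (<⇒≢ (f-mono i<j) fi≡fj)
  ... | tri≈ _ i≡j _ = i≡j
  ... | tri> _ _ j<i = ⊥-elim (<⇒≢ (f-mono j<i) (sym fi≡fj))

  dedup-map : ∀ xs → dedup (map f xs) ≡ map f (dedup xs)
  dedup-map [] = refl
  dedup-map (x ∷ xs) = cong (f x ∷_) (trans (cong (filter _) (dedup-map xs)) (filter-map f _ _ ≢fx⇔≢x (dedup xs)))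
    where
    ≢fx⇔≢x : ∀ a → (¬ T (f x ≡ᵇ f a) → ¬ T (x ≡ᵇ a)) × (¬ T (x ≡ᵇ a) → ¬ T (f x ≡ᵇ f a))
    ≢fx⇔≢x a = (λ ne t → ne (≡⇒≡ᵇ (f x) (f a) (cong f (≡ᵇ⇒≡ x a t))))
             , (λ ne t → ne (≡⇒≡ᵇ x a (mono-injective (≡ᵇ⇒≡ (f x) (f a) t))))

  rank-map : ∀ s y → rank (map f s) (f y) ≡ rank s y
  rank-map s y = begin
    length (dedup (filter (_<? f y) (map f s)))  ≡⟨ cong (length ∘ dedup) (filter-map f _ _ (λ _ → mono-reflects-< , f-mono) s) ⟩
    length (dedup (map f (filter (_<? y) s)))    ≡⟨ cong length (dedup-map (filter (_<? y) s)) ⟩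
    length (map f (dedup (filter (_<? y) s)))    ≡⟨ length-map f (dedup (filter (_<? y) s)) ⟩
    rank s y                                     ∎
    where open ≡-Reasoning

  red-map : ∀ s → red (map f s) ≡ red s
  red-map s = trans (sym (map-∘ {g = rank (map f s)} s)) (map-cong (rank-map s) s)

Increasing : ℕ → List ℕ → Set
Increasing v [] = ⊤
Increasing v (w ∷ ws) = v < w × Increasing w ws

-- i ↦ (v ∷ ws)ᵢ, continued past the end so that it stays increasing
chainMap : ℕ → List ℕ → ℕ → ℕ
chainMap v [] n = n + v
chainMap v (w ∷ ws) zero = v
chainMap v (w ∷ ws) (suc n) = chainMap w ws n

chainMap-step : ∀ v ws → Increasing v ws → ∀ n → chainMap v ws n < chainMap v ws (suc n)
chainMap-step v [] _ n = ≤-refl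
chainMap-step v (w ∷ []) (v<w , _) zero = v<w
chainMap-step v (w ∷ w′ ∷ ws) (v<w , _) zero = v<w
chainMap-step v (w ∷ ws) (_ , inc) (suc n) = chainMap-step w ws inc n

chainMap-mono : ∀ v ws → Increasing v ws → chainMap v ws Preserves _<_ ⟶ _<_
chainMap-mono v ws inc {i} {suc j} (s≤s i≤j) with m≤n⇒m<n∨m≡n i≤j
... | inj₂ refl = chainMap-step v ws inc i
... | inj₁ i<j = <-trans (chainMap-mono v ws inc i<j) (chainMap-step v ws inc j)

Occurs-chain : ∀ v ws → Increasing v ws → ∀ p {x} → red p ≡ p → map (chainMap v ws) p ⊆ x → Occurs p x
Occurs-chain v ws inc p red-p fp⊆x = map (chainMap v ws) p , fp⊆x , trans (red-map (chainMap-mono v ws inc) p) red-p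

Occurs-101 : ∀ {a b x} → b < a → a ∷ b ∷ a ∷ [] ⊆ x → Occurs (1 ∷ 0 ∷ 1 ∷ []) x
Occurs-101 {a} {b} b<a = Occurs-chain b (a ∷ []) (b<a , tt) (1 ∷ 0 ∷ 1 ∷ []) refl

Occurs-120 : ∀ {a b c x} → a < b → b < c → b ∷ c ∷ a ∷ [] ⊆ x → Occurs (1 ∷ 2 ∷ 0 ∷ []) x
Occurs-120 {a} {b} {c} a<b b<c = Occurs-chain a (b ∷ c ∷ []) (a<b , b<c , tt) (1 ∷ 2 ∷ 0 ∷ []) refl

Occurs-0101 : ∀ {a b x} → a < b → a ∷ b ∷ a ∷ b ∷ [] ⊆ x → Occurs (0 ∷ 1 ∷ 0 ∷ 1 ∷ []) x
Occurs-0101 {a} {b} a<b = Occurs-chain a (b ∷ []) (a<b , tt) (0 ∷ 1 ∷ 0 ∷ 1 ∷ []) refl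

Occurs-0120 : ∀ {a b c x} → a < b → b < c → a ∷ b ∷ c ∷ a ∷ [] ⊆ x → Occurs (0 ∷ 1 ∷ 2 ∷ 0 ∷ []) x
Occurs-0120 {a} {b} {c} a<b b<c = Occurs-chain a (b ∷ c ∷ []) (a<b , b<c , tt) (0 ∷ 1 ∷ 2 ∷ 0 ∷ []) refl

Occurs-3012 : ∀ {a b c d x} → a < b → b < c → c < d → d ∷ a ∷ b ∷ c ∷ [] ⊆ x → Occurs (3 ∷ 0 ∷ 1 ∷ 2 ∷ []) x
Occurs-3012 {a} {b} {c} {d} a<b b<c c<d =
  Occurs-chain a (b ∷ c ∷ d ∷ []) (a<b , b<c , c<d , tt) (3 ∷ 0 ∷ 1 ∷ 2 ∷ []) refl

⊆-split-++ : ∀ {s : List ℕ} x₁ {x₂} → s ⊆ x₁ ++ x₂ →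
  ∃ λ s₁ → ∃ λ s₂ → s ≡ s₁ ++ s₂ × s₁ ⊆ x₁ × s₂ ⊆ x₂
⊆-split-++ [] s⊆ = [] , _ , refl , [] , s⊆
⊆-split-++ (y ∷ x₁) (.y ∷ʳ s⊆) with ⊆-split-++ x₁ s⊆
... | s₁ , s₂ , refl , s₁⊆ , s₂⊆ = s₁ , s₂ , refl , y ∷ʳ s₁⊆ , s₂⊆
⊆-split-++ (y ∷ x₁) (refl ∷ s⊆) with ⊆-split-++ x₁ s⊆
... | s₁ , s₂ , refl , s₁⊆ , s₂⊆ = y ∷ s₁ , s₂ , refl , refl ∷ s₁⊆ , s₂⊆

⊆-insert : ∀ (u : List ℕ) m w → u ++ w ⊆ u ++ m ∷ w
⊆-insert u m w = ++⁺ ⊆-refl (m ∷ʳ ⊆-refl)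

⊆-insert⁻ : ∀ {s : List ℕ} u m w → s ⊆ u ++ m ∷ w →
  s ⊆ u ++ w ⊎ ∃ λ s₁ → ∃ λ s₂ → s ≡ s₁ ++ m ∷ s₂ × s₁ ⊆ u × s₂ ⊆ w
⊆-insert⁻ u m w s⊆ with ⊆-split-++ u s⊆
... | s₁ , s₂ , refl , s₁⊆ , .m ∷ʳ s₂⊆ = inj₁ (++⁺ s₁⊆ s₂⊆)
... | s₁ , .(m ∷ _) , refl , s₁⊆ , refl ∷ s₂⊆ = inj₂ (s₁ , _ , refl , s₁⊆ , s₂⊆)

⊆-snoc⁻ : ∀ {s : List ℕ} x v → s ⊆ x ++ [ v ] → s ⊆ x ⊎ ∃ λ s₁ → s ≡ s₁ ++ [ v ] × s₁ ⊆ x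
⊆-snoc⁻ {s} x v s⊆ with ⊆-insert⁻ x v [] s⊆
... | inj₁ s⊆x = inj₁ (subst (s ⊆_) (++-identityʳ x) s⊆x)
... | inj₂ (s₁ , .[] , refl , s₁⊆ , []) = inj₂ (s₁ , refl , s₁⊆)

∷-⊆-split : ∀ {a : ℕ} {s x} → a ∷ s ⊆ x → ∃ λ u → ∃ λ w → x ≡ u ++ a ∷ w × s ⊆ w
∷-⊆-split (y ∷ʳ a∷s⊆) with ∷-⊆-split a∷s⊆
... | u , w , refl , s⊆w = y ∷ u , w , refl , s⊆w
∷-⊆-split (refl ∷ s⊆) = [] , _ , refl , s⊆

pair-⊆-snoc⁻ : ∀ {a b : ℕ} x v → a ∷ b ∷ [] ⊆ x ++ [ v ] → a ∷ b ∷ [] ⊆ x ⊎ (a ∈ x × b ≡ v)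
pair-⊆-snoc⁻ x v ab⊆ with ⊆-snoc⁻ x v ab⊆
... | inj₁ ab⊆x = inj₁ ab⊆x
... | inj₂ (_ ∷ [] , refl , a⊆x) = inj₂ (Sublist.lookup a⊆x (here refl) , refl)
... | inj₂ (_ ∷ _ ∷ s , e , _) with ++-conicalʳ s [ v ] (sym (proj₂ (∷-injective (proj₂ (∷-injective e)))))
...   | ()

Occurs-insert⁻ : ∀ {p} u m w → Occurs p (u ++ m ∷ w) →
  Occurs p (u ++ w) ⊎
  ∃ λ s₁ → ∃ λ s₂ → s₁ ⊆ u × s₂ ⊆ w × red (s₁ ++ m ∷ s₂) ≡ p × suc (length (s₁ ++ s₂)) ≡ length p
Occurs-insert⁻ u m w (s , s⊆ , e) with ⊆-insert⁻ u m w s⊆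
... | inj₁ s⊆′ = inj₁ (s , s⊆′ , e)
... | inj₂ (s₁ , s₂ , refl , s₁⊆ , s₂⊆) =
  inj₂ (s₁ , s₂ , s₁⊆ , s₂⊆ , e ,
        trans (sym (length-++-sucʳ s₁ m s₂)) (trans (sym (length-red (s₁ ++ m ∷ s₂))) (cong length e)))

Occurs-snoc⁻ : ∀ {p} x v → Occurs p (x ++ [ v ]) →
  Occurs p x ⊎ ∃ λ s → s ⊆ x × red (s ++ [ v ]) ≡ p × suc (length s) ≡ length p
Occurs-snoc⁻ {p} x v occ with Occurs-insert⁻ x v [] occ
... | inj₁ occ′ = inj₁ (subst (Occurs p) (++-identityʳ x) occ′)
... | inj₂ (s , .[] , s⊆ , [] , e , len) = inj₂ (s , s⊆ , e , trans (cong (suc ∘ length) (sym (++-identityʳ s))) len)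

¬Occurs₃-snoc : ∀ {p₀ p₁ p₂} x v → ¬ Occurs (p₀ ∷ p₁ ∷ p₂ ∷ []) x →
  (∀ {a b} → a ∷ b ∷ [] ⊆ x → red (a ∷ b ∷ v ∷ []) ≢ p₀ ∷ p₁ ∷ p₂ ∷ []) →
  ¬ Occurs (p₀ ∷ p₁ ∷ p₂ ∷ []) (x ++ [ v ])
¬Occurs₃-snoc x v ¬occ ¬last occ with Occurs-snoc⁻ x v occ
... | inj₁ occ′ = ¬occ occ′
... | inj₂ (a ∷ b ∷ [] , ab⊆ , e , _) = ¬last ab⊆ e
... | inj₂ ([] , _ , _ , ())
... | inj₂ (_ ∷ [] , _ , _ , ())
... | inj₂ (_ ∷ _ ∷ _ ∷ _ , _ , _ , ())

¬Occurs₄-snoc : ∀ {p₀ p₁ p₂ p₃} x v → ¬ Occurs (p₀ ∷ p₁ ∷ p₂ ∷ p₃ ∷ []) x →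
  (∀ {a b c} → a ∷ b ∷ c ∷ [] ⊆ x → red (a ∷ b ∷ c ∷ v ∷ []) ≢ p₀ ∷ p₁ ∷ p₂ ∷ p₃ ∷ []) →
  ¬ Occurs (p₀ ∷ p₁ ∷ p₂ ∷ p₃ ∷ []) (x ++ [ v ])
¬Occurs₄-snoc x v ¬occ ¬last occ with Occurs-snoc⁻ x v occ
... | inj₁ occ′ = ¬occ occ′
... | inj₂ (a ∷ b ∷ c ∷ [] , abc⊆ , e , _) = ¬last abc⊆ e
... | inj₂ ([] , _ , _ , ())
... | inj₂ (_ ∷ [] , _ , _ , ())
... | inj₂ (_ ∷ _ ∷ [] , _ , _ , ())
... | inj₂ (_ ∷ _ ∷ _ ∷ _ ∷ _ , _ , _ , ())

-- Generating trees

data Label : Set where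
  LA LB LC : Label

children : Label → List Label
children LA = LA ∷ LC ∷ []
children LB = LB ∷ LA ∷ []
children LC = LC ∷ LB ∷ LC ∷ []

descendants : ℕ → Label → ℕ
descendants zero l = 1
descendants (suc n) l = sum (map (descendants n) (children l))

descendants-rec : ∀ n → descendants (3 + n) LA + 5 * descendants (1 + n) LA ≡ 4 * descendants (2 + n) LA + 3 * descendants n LA
-- Cayley–Hamilton for the transfer matrix of the rule, unfolded three levels deep
descendants-rec n = identity (descendants n LA) (descendants n LB) (descendants n LC)
  where
  identity : ∀ a b c →
    (((a + (c + 0)) + ((c + (b + (c + 0))) + 0)) + (((c + (b + (c + 0))) + ((b + (a + 0)) + ((c + (b + (c + 0))) + 0))) + 0))
      + 5 * (a + (c + 0))
    ≡ 4 * ((a + (c + 0)) + ((c + (b + (c + 0))) + 0)) + 3 * a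
  identity = ℕ-Solver.solve-∀

module _ {E : Set} (label : E → Label) (expand : ℕ → E → List E)
         (expand-label : ∀ n e → map label (expand n e) ≡ children (label e)) where

  grow : List E → ℕ → List E
  grow L zero = L
  grow L (suc n) = concatMap (expand n) (grow L n)

  sum-descendants-expand : ∀ k n L →
    sum (map (descendants k ∘ label) (concatMap (expand n) L)) ≡ sum (map (descendants (suc k) ∘ label) L)
  sum-descendants-expand k n [] = refl
  sum-descendants-expand k n (e ∷ L) = begin
    sum (map (descendants k ∘ label) (expand n e ++ concatMap (expand n) L))
      ≡⟨ cong sum (map-++ (descendants k ∘ label) (expand n e) _) ⟩
    sum (map (descendants k ∘ label) (expand n e) ++ map (descendants k ∘ label) (concatMap (expand n) L))
      ≡⟨ sum-++ (map (descendants k ∘ label) (expand n e)) _ ⟩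
    sum (map (descendants k ∘ label) (expand n e)) + sum (map (descendants k ∘ label) (concatMap (expand n) L))
      ≡⟨ cong₂ _+_ (trans (cong sum (map-∘ (expand n e))) (cong (sum ∘ map (descendants k)) (expand-label n e)))
                   (sum-descendants-expand k n L) ⟩
    descendants (suc k) (label e) + sum (map (descendants (suc k) ∘ label) L) ∎
    where
    open ≡-Reasoning

  sum-descendants-grow : ∀ L n k → sum (map (descendants k ∘ label) (grow L n)) ≡ sum (map (descendants (k + n) ∘ label) L)
  sum-descendants-grow L zero k rewrite +-identityʳ k = refl
  sum-descendants-grow L (suc n) k rewrite +-suc k n =
    trans (sum-descendants-expand k n (grow L n)) (sum-descendants-grow L n (suc k))

  length-grow : ∀ L n → length (grow L n) ≡ sum (map (descendants n ∘ label) L)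
  length-grow L n = trans (sym (sum-map-1 (grow L n))) (sum-descendants-grow L n 0)
    where
    sum-map-1 : ∀ (xs : List E) → sum (map (descendants 0 ∘ label) xs) ≡ length xs
    sum-map-1 [] = refl
    sum-map-1 (_ ∷ xs) = cong suc (sum-map-1 xs)

  All-grow : ∀ {L} (P : ℕ → E → Set) → (∀ {e} → e ∈ L → P 0 e) →
    (∀ {n e c} → P n e → c ∈ expand n e → P (suc n) c) → ∀ n {e} → e ∈ grow L n → P n e
  All-grow P P-root P-expand zero e∈ = P-root e∈
  All-grow P P-root P-expand (suc n) c∈ with find (∈-concatMap⁻ (expand n) c∈)
  ... | e , e∈ , c∈e = P-expand (All-grow P P-root P-expand n e∈) c∈e

  ∈-grow-suc : ∀ {L n e c} → e ∈ grow L n → c ∈ expand n e → c ∈ grow L (suc n)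
  ∈-grow-suc {n = n} e∈ c∈e = ∈-concatMap⁺ (expand n) (Any.map (λ { refl → c∈e }) e∈)

  Unique-grow : ∀ {X : Set} (obj : E → X) (P : ℕ → E → Set) {L} →
    (∀ {n e} → e ∈ grow L n → P n e) →
    (∀ {n e} → P n e → Unique (map obj (expand n e))) →
    (∀ {n e e′ c c′} → P n e → P n e′ → c ∈ expand n e → c′ ∈ expand n e′ →
                       obj c ≡ obj c′ → obj e ≡ obj e′) →
    Unique (map obj L) → ∀ n → Unique (map obj (grow L n))
  Unique-grow obj P inv uniq parent u zero = u
  Unique-grow obj P {L} inv uniq parent u (suc n) =
    Unique-concatMap (grow L n) (uniq ∘ inv) inv (Unique-grow obj P inv uniq parent u n)
    where
    Unique-concatMap : ∀ M → (∀ {e} → e ∈ M → Unique (map obj (expand n e))) → (∀ {e} → e ∈ M → P n e) →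
      Unique (map obj M) → Unique (map obj (concatMap (expand n) M))
    Unique-concatMap [] _ _ _ = []
    Unique-concatMap (e ∷ M) uniqM invM (obj-e∉ ∷ uM) rewrite map-++ obj (expand n e) (concatMap (expand n) M) =
      Unique-++⁺ (uniqM (here refl)) (Unique-concatMap M (uniqM ∘ there) (invM ∘ there) uM) disjoint
      where
      disjoint : Disjoint (map obj (expand n e)) (map obj (concatMap (expand n) M))
      disjoint (v∈ , v∈′) with ∈-map⁻ obj v∈ | ∈-map⁻ obj v∈′
      ... | c , c∈ , refl | c′ , c′∈ , c≡c′ with find (∈-concatMap⁻ (expand n) c′∈)
      ... | e′ , e′∈ , c′∈e′ =
        All.lookup obj-e∉ (∈-map⁺ obj e′∈) (parent (invM (here refl)) (invM (there e′∈)) c∈ c′∈e′ c≡c′)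

Unique⇒index-lookup : ∀ {X : Set} {L : List X} {x} → Unique L → (x∈ : x ∈ L) → ∀ i → lookup L i ≡ x → index x∈ ≡ i
Unique⇒index-lookup u (here refl) Fin.zero _ = refl
Unique⇒index-lookup {L = _ ∷ L} (y∉ ∷ _) (here refl) (Fin.suc i) e = ⊥-elim (All.lookup y∉ (∈-lookup i) (sym e))
Unique⇒index-lookup (y∉ ∷ _) (there x∈) Fin.zero refl = ⊥-elim (All.lookup y∉ x∈ refl)
Unique⇒index-lookup (_ ∷ u) (there x∈) (Fin.suc i) e = cong Fin.suc (Unique⇒index-lookup u x∈ i e)

enumeration : ∀ {X : Set} (p : X → Bool) (L : List X) → Unique L →
  (∀ {x} → T (p x) → x ∈ L) → (∀ {x} → x ∈ L → T (p x)) → Σ X (T ∘ p) ↔ Fin (length L)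
enumeration p L u complete sound = mk↔ₛ′ to from to∘from from∘to
  where
  to : Σ _ (T ∘ p) → Fin (length L)
  to (x , px) = index (complete px)
  from : Fin (length L) → Σ _ (T ∘ p)
  from i = lookup L i , sound (∈-lookup i)
  to∘from : ∀ i → to (from i) ≡ i
  to∘from i = Unique⇒index-lookup u (complete (sound (∈-lookup i))) i refl
  from∘to : ∀ xp → from (to xp) ≡ xp
  from∘to (x , px) = ≡-with-T (sym (lookup-index (complete px)))
    where
    ≡-with-T : ∀ {y z} {py : T (p y)} {pz : T (p z)} → y ≡ z → (y , py) ≡ (z , pz)
    ≡-with-T refl = cong (_ ,_) (T-irrelevant _ _)

-- Ascent sequences

length-snoc : ∀ (x : List ℕ) v → length (x ++ [ v ]) ≡ suc (length x)
length-snoc x v = trans (length-++-sucʳ x v []) (cong (suc ∘ length) (++-identityʳ x))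

ascentBit : ℕ → ℕ → ℕ
ascentBit a b = if a <ᵇ b then 1 else 0

ascentBit-< : ∀ {a b} → a < b → ascentBit a b ≡ 1
ascentBit-< {a} {b} a<b with a <ᵇ b | <⇒<ᵇ a<b
... | true | _ = refl

ascentBit-≥ : ∀ {a b} → b ≤ a → ascentBit a b ≡ 0
ascentBit-≥ {a} {b} b≤a with a <ᵇ b in eq
... | false = refl
... | true = ⊥-elim (<⇒≱ (<ᵇ⇒< a b (subst T (sym eq) _)) b≤a)

asc-snoc : ∀ pre ℓ v → asc ((pre ++ [ ℓ ]) ++ [ v ]) ≡ asc (pre ++ [ ℓ ]) + ascentBit ℓ v
asc-snoc [] ℓ v = +-comm (ascentBit ℓ v) 0
asc-snoc (a ∷ []) ℓ v = trans (cong (λ t → ascentBit a ℓ + t) (+-identityʳ _)) (cong (_+ ascentBit ℓ v) (sym (+-identityʳ _)))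
asc-snoc (a ∷ b ∷ pre) ℓ v = trans (cong (λ t → ascentBit a b + t) (asc-snoc (b ∷ pre) ℓ v)) (sym (+-assoc (ascentBit a b) _ _))

ascentCond-snoc : ∀ pre ys v → ascentCond pre (ys ++ [ v ]) ≡ ascentCond pre ys ∧ (v ≤ᵇ suc (asc (pre ++ ys)))
ascentCond-snoc pre [] v = trans (∧-identityʳ _) (cong (λ t → v ≤ᵇ suc (asc t)) (sym (++-identityʳ pre)))
ascentCond-snoc pre (y ∷ ys) v = begin
  (y ≤ᵇ suc (asc pre)) ∧ ascentCond (pre ++ [ y ]) (ys ++ [ v ])
    ≡⟨ cong ((y ≤ᵇ suc (asc pre)) ∧_) (ascentCond-snoc (pre ++ [ y ]) ys v) ⟩
  (y ≤ᵇ suc (asc pre)) ∧ (ascentCond (pre ++ [ y ]) ys ∧ (v ≤ᵇ suc (asc ((pre ++ [ y ]) ++ ys))))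
    ≡⟨ sym (∧-assoc (y ≤ᵇ suc (asc pre)) _ _) ⟩
  ((y ≤ᵇ suc (asc pre)) ∧ ascentCond (pre ++ [ y ]) ys) ∧ (v ≤ᵇ suc (asc ((pre ++ [ y ]) ++ ys)))
    ≡⟨ cong (λ t → ((y ≤ᵇ suc (asc pre)) ∧ ascentCond (pre ++ [ y ]) ys) ∧ (v ≤ᵇ suc (asc t))) (++-assoc pre [ y ] ys) ⟩
  ((y ≤ᵇ suc (asc pre)) ∧ ascentCond (pre ++ [ y ]) ys) ∧ (v ≤ᵇ suc (asc (pre ++ y ∷ ys))) ∎
  where open ≡-Reasoning

isAscentSeq-snoc : ∀ a r v → isAscentSeq ((a ∷ r) ++ [ v ]) ≡ isAscentSeq (a ∷ r) ∧ (v ≤ᵇ suc (asc (a ∷ r)))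
isAscentSeq-snoc a r v = trans (cong ((a ≡ᵇ 0) ∧_) (ascentCond-snoc [ a ] r v)) (sym (∧-assoc (a ≡ᵇ 0) _ _))

isAscentSeq-snoc⁺ : ∀ x v → T (isAscentSeq x) → v ≤ suc (asc x) → T (isAscentSeq (x ++ [ v ]))
isAscentSeq-snoc⁺ (a ∷ r) v asc-x v≤ rewrite isAscentSeq-snoc a r v = T-∧⁺ {isAscentSeq (a ∷ r)} asc-x (≤⇒≤ᵇ v≤)

isAscentSeq-snoc⁻ : ∀ a r v → T (isAscentSeq ((a ∷ r) ++ [ v ])) → T (isAscentSeq (a ∷ r)) × v ≤ suc (asc (a ∷ r))
isAscentSeq-snoc⁻ a r v t rewrite isAscentSeq-snoc a r v with T-∧⁻ {isAscentSeq (a ∷ r)} t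
... | asc-x , v≤ = asc-x , ≤ᵇ⇒≤ v _ v≤

-- An occurrence through both final copies of ℓ ends in two equal letters; one through the last copy only
-- can use the previous copy instead.
¬Occurs-repeat-last : ∀ q a b pre ℓ → a ≢ b →
  ¬ Occurs ((q ++ [ a ]) ++ [ b ]) (pre ++ [ ℓ ]) → ¬ Occurs ((q ++ [ a ]) ++ [ b ]) ((pre ++ [ ℓ ]) ++ [ ℓ ])
¬Occurs-repeat-last q a b pre ℓ a≢b ¬occ occ with Occurs-snoc⁻ (pre ++ [ ℓ ]) ℓ occ
... | inj₁ occ′ = ¬occ occ′
... | inj₂ (s , s⊆ , e , _) with ⊆-snoc⁻ pre ℓ s⊆
...   | inj₁ s⊆pre = ¬occ (s ++ [ ℓ ] , ++⁺ s⊆pre ⊆-refl , e)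
...   | inj₂ (t , refl , _)
  with ∷ʳ-injective _ (q ++ [ a ]) (trans (sym (map-++ (rank ((t ++ [ ℓ ]) ++ [ ℓ ])) (t ++ [ ℓ ]) [ ℓ ])) e)
...     | init≡ , fℓ≡b with ∷ʳ-injective _ q (trans (sym (map-++ (rank ((t ++ [ ℓ ]) ++ [ ℓ ])) t [ ℓ ])) init≡)
...       | _ , fℓ≡a = a≢b (trans (sym fℓ≡a) fℓ≡b)

-- In an occurrence ending at the new maximum v, the last letter exceeds all others; the pattern's does not.
¬Occurs-new-max : ∀ q b {a} → a ∈ q → b ≤ a → ∀ x v → (∀ {c} → c ∈ x → c < v) →
  ¬ Occurs (q ++ [ b ]) x → ¬ Occurs (q ++ [ b ]) (x ++ [ v ])
¬Occurs-new-max q b {a} a∈q b≤a x v x<v ¬occ occ with Occurs-snoc⁻ x v occ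
... | inj₁ occ′ = ¬occ occ′
... | inj₂ (s , s⊆ , e , _)
  with ∷ʳ-injective (map (rank (s ++ [ v ])) s) q (trans (sym (map-++ (rank (s ++ [ v ])) s [ v ])) e)
...   | rs≡q , rv≡b with ∈-map⁻ (rank (s ++ [ v ])) (subst (a ∈_) (sym rs≡q) a∈q)
...     | c , c∈s , refl =
  <⇒≱ (rank-strict (s ++ [ v ]) (∈-++⁺ˡ c∈s) (x<v (Sublist.lookup s⊆ c∈s))) (subst (_≤ a) (sym rv≡b) b≤a)

Pat₃ Pat₄ : List (List ℕ)
Pat₃ = (1 ∷ 0 ∷ 1 ∷ []) ∷ (1 ∷ 2 ∷ 0 ∷ []) ∷ []
Pat₄ = (0 ∷ 1 ∷ 0 ∷ 1 ∷ []) ∷ (0 ∷ 1 ∷ 2 ∷ 0 ∷ []) ∷ []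

Avoids₃-repeat-last : ∀ pre ℓ → Avoids Pat₃ (pre ++ [ ℓ ]) → Avoids Pat₃ ((pre ++ [ ℓ ]) ++ [ ℓ ])
Avoids₃-repeat-last pre ℓ (¬101 ∷ ¬120 ∷ []) =
  ¬Occurs-repeat-last [ 1 ] 0 1 pre ℓ (λ ()) ¬101 ∷ ¬Occurs-repeat-last [ 1 ] 2 0 pre ℓ (λ ()) ¬120 ∷ []

Avoids₄-repeat-last : ∀ pre ℓ → Avoids Pat₄ (pre ++ [ ℓ ]) → Avoids Pat₄ ((pre ++ [ ℓ ]) ++ [ ℓ ])
Avoids₄-repeat-last pre ℓ (¬0101 ∷ ¬0120 ∷ []) =
  ¬Occurs-repeat-last (0 ∷ 1 ∷ []) 0 1 pre ℓ (λ ()) ¬0101 ∷ ¬Occurs-repeat-last (0 ∷ 1 ∷ []) 2 0 pre ℓ (λ ()) ¬0120 ∷ []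

Avoids₃-new-max : ∀ x v → (∀ {c} → c ∈ x → c < v) → Avoids Pat₃ x → Avoids Pat₃ (x ++ [ v ])
Avoids₃-new-max x v x<v (¬101 ∷ ¬120 ∷ []) =
  ¬Occurs-new-max (1 ∷ 0 ∷ []) 1 (here refl) ≤-refl x v x<v ¬101
  ∷ ¬Occurs-new-max (1 ∷ 2 ∷ []) 0 (here refl) z≤n x v x<v ¬120 ∷ []

Avoids₄-new-max : ∀ x v → (∀ {c} → c ∈ x → c < v) → Avoids Pat₄ x → Avoids Pat₄ (x ++ [ v ])
Avoids₄-new-max x v x<v (¬0101 ∷ ¬0120 ∷ []) =
  ¬Occurs-new-max (0 ∷ 1 ∷ 0 ∷ []) 1 (there (here refl)) ≤-refl x v x<v ¬0101
  ∷ ¬Occurs-new-max (0 ∷ 1 ∷ 2 ∷ []) 0 (here refl) z≤n x v x<v ¬0120 ∷ []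

NothingBelowAfter : ℕ → List ℕ → Set
NothingBelowAfter k x = ∀ {b} → k ∷ b ∷ [] ⊆ x → k ≤ b

record Admissible (M ℓ : ℕ) (x : List ℕ) : Set where
  field
    init           : List ℕ
    x≡init∷ʳℓ      : x ≡ init ++ [ ℓ ]
    ascent         : T (isAscentSeq x)
    asc≡M          : asc x ≡ M
    ≤M             : ∀ {a} → a ∈ x → a ≤ M
    M∈             : M ∈ x
    smaller-before : ∀ {a b} u w → a < b → b ≤ M → x ≡ u ++ b ∷ w → a ∈ u
    avoids₃        : Avoids Pat₃ x
    avoids₄        : Avoids Pat₄ x

module _ {M ℓ x} (adm : Admissible M ℓ x) where
  open Admissible adm

  ℓ≤M : ℓ ≤ M
  ℓ≤M = ≤M (subst (ℓ ∈_) (sym x≡init∷ʳℓ) (∈-++⁺ʳ init (here refl)))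

  ≤M⇒∈ : ∀ {a} → a ≤ M → a ∈ x
  ≤M⇒∈ {a} a≤M with m≤n⇒m<n∨m≡n a≤M | ∈-∃++ M∈
  ... | inj₂ refl | _ = M∈
  ... | inj₁ a<M | u , w , x≡ = subst (a ∈_) (sym x≡) (∈-++⁺ˡ (smaller-before u w a<M ≤-refl x≡))

  ∷M⊆ : ∀ {c} → c < M → c ∷ M ∷ [] ⊆ x
  ∷M⊆ {c} c<M with ∈-∃++ M∈
  ... | u , w , x≡ = subst (c ∷ M ∷ [] ⊆_) (sym x≡) (++⁺ (from∈ (smaller-before u w c<M ≤-refl x≡)) (refl ∷ minimum w))

  prepend-smaller : ∀ {a c d} → c ∷ d ∷ [] ⊆ x → a < c → a ∷ c ∷ d ∷ [] ⊆ x
  prepend-smaller {a} {c} {d} cd⊆ a<c with ∷-⊆-split cd⊆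
  ... | u , w , x≡ , d⊆w = subst (a ∷ c ∷ d ∷ [] ⊆_) (sym x≡)
        (++⁺ (from∈ (smaller-before u w a<c (≤M (subst (c ∈_) (sym x≡) (∈-++⁺ʳ u (here refl)))) x≡)) (refl ∷ d⊆w))

  snoc : ∀ v M′ → v ≤ suc M → M + ascentBit ℓ v ≡ M′ → M ≤ M′ → v ≤ M′ → M′ ∈ x ++ [ v ] →
    Avoids Pat₃ (x ++ [ v ]) → Avoids Pat₄ (x ++ [ v ]) → Admissible M′ v (x ++ [ v ])
  snoc v M′ v≤1+M M′≡ M≤M′ v≤M′ M′∈ av₃ av₄ = record
    { init = x
    ; x≡init∷ʳℓ = refl
    ; ascent = isAscentSeq-snoc⁺ x v ascent (subst (λ m → v ≤ suc m) (sym asc≡M) v≤1+M)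
    ; asc≡M = asc≡M′
    ; ≤M = ≤M′
    ; M∈ = M′∈
    ; smaller-before = smaller-before′
    ; avoids₃ = av₃
    ; avoids₄ = av₄
    }
    where
    asc≡M′ : asc (x ++ [ v ]) ≡ M′
    asc≡M′ rewrite x≡init∷ʳℓ | asc-snoc init ℓ v =
      trans (cong (_+ ascentBit ℓ v) (trans (cong asc (sym x≡init∷ʳℓ)) asc≡M)) M′≡
    ≤M′ : ∀ {a} → a ∈ x ++ [ v ] → a ≤ M′
    ≤M′ a∈ with ∈-++⁻ x a∈
    ... | inj₁ a∈x = ≤-trans (≤M a∈x) M≤M′
    ... | inj₂ (here refl) = v≤M′
    smaller-before′ : ∀ {a b} u w → a < b → b ≤ M′ → x ++ [ v ] ≡ u ++ b ∷ w → a ∈ u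
    smaller-before′ {a} {b} u w a<b b≤M′ x∷ʳv≡ with initLast w
    ... | [] with ∷ʳ-injective x u x∷ʳv≡
    ...   | refl , refl = ≤M⇒∈ (≤-pred (<-≤-trans a<b v≤1+M))
    smaller-before′ {a} {b} u w a<b b≤M′ x∷ʳv≡ | w′ ∷ʳ′ v′
      with ∷ʳ-injective x (u ++ b ∷ w′) (trans x∷ʳv≡ (sym (++-assoc u (b ∷ w′) [ v′ ])))
    ...   | x≡ , refl = smaller-before u w′ a<b (≤M (subst (b ∈_) (sym x≡) (∈-++⁺ʳ u (here refl)))) x≡

  repeat-last : Admissible M ℓ (x ++ [ ℓ ])
  repeat-last =
    snoc ℓ M (m≤n⇒m≤1+n ℓ≤M) (trans (cong (λ t → M + t) (ascentBit-≥ {ℓ} ≤-refl)) (+-identityʳ M)) ≤-refl ℓ≤M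
    (∈-++⁺ˡ M∈) (at-x Avoids₃-repeat-last avoids₃) (at-x Avoids₄-repeat-last avoids₄)
    where
    at-x : ∀ {P} → (∀ pre ℓ → Avoids P (pre ++ [ ℓ ]) → Avoids P ((pre ++ [ ℓ ]) ++ [ ℓ ])) →
      Avoids P x → Avoids P (x ++ [ ℓ ])
    at-x {P} lemma av = subst (λ y → Avoids P (y ++ [ ℓ ])) (sym x≡init∷ʳℓ) (lemma init ℓ (subst (Avoids P) x≡init∷ʳℓ av))

  new-max : Admissible (suc M) (suc M) (x ++ [ suc M ])
  new-max = snoc (suc M) (suc M) ≤-refl (trans (cong (λ t → M + t) (ascentBit-< (s≤s ℓ≤M))) (+-comm M 1)) (n≤1+n M) ≤-refl
    (∈-++⁺ʳ x (here refl)) (Avoids₃-new-max x (suc M) (s≤s ∘ ≤M) avoids₃) (Avoids₄-new-max x (suc M) (s≤s ∘ ≤M) avoids₄)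

module _ {k x} (adm : Admissible (suc k) (suc k) x) (k-floor : NothingBelowAfter k x) where
  open Admissible adm

  dip : Admissible (suc k) k (x ++ [ k ])
  dip = snoc adm k (suc k) (m≤n⇒m≤1+n (n≤1+n k)) (trans (cong (λ t → suc k + t) (ascentBit-≥ (n≤1+n k))) (+-identityʳ (suc k)))
    ≤-refl (n≤1+n k) (∈-++⁺ˡ M∈) av₃ av₄
    where
    av₃ : Avoids Pat₃ (x ++ [ k ])
    av₃ with avoids₃
    ... | ¬101 ∷ ¬120 ∷ [] = ¬Occurs₃-snoc x k ¬101 no-101 ∷ ¬Occurs₃-snoc x k ¬120 no-120 ∷ []
      where
      no-101 : ∀ {a b} → a ∷ b ∷ [] ⊆ x → red (a ∷ b ∷ k ∷ []) ≢ 1 ∷ 0 ∷ 1 ∷ []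
      no-101 {a} {b} ab⊆ e with red≡101⇒ a b k e
      ... | b<a , refl = <⇒≱ b<a (k-floor ab⊆)
      no-120 : ∀ {a b} → a ∷ b ∷ [] ⊆ x → red (a ∷ b ∷ k ∷ []) ≢ 1 ∷ 2 ∷ 0 ∷ []
      no-120 {a} {b} ab⊆ e with red≡120⇒ a b k e
      ... | k<a , a<b = <⇒≱ k<a (≤-pred (<-≤-trans a<b (≤M (Sublist.lookup ab⊆ (there (here refl))))))
    av₄ : Avoids Pat₄ (x ++ [ k ])
    av₄ with avoids₄
    ... | ¬0101 ∷ ¬0120 ∷ [] = ¬Occurs₄-snoc x k ¬0101 no-0101 ∷ ¬Occurs₄-snoc x k ¬0120 no-0120 ∷ []
      where
      no-0101 : ∀ {a b c} → a ∷ b ∷ c ∷ [] ⊆ x → red (a ∷ b ∷ c ∷ k ∷ []) ≢ 0 ∷ 1 ∷ 0 ∷ 1 ∷ []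
      no-0101 {a} {b} {c} abc⊆ e with red≡0101⇒ a b c k e
      ... | a<k , refl , refl = <⇒≱ a<k (k-floor (∷ˡ⁻ abc⊆))
      no-0120 : ∀ {a b c} → a ∷ b ∷ c ∷ [] ⊆ x → red (a ∷ b ∷ c ∷ k ∷ []) ≢ 0 ∷ 1 ∷ 2 ∷ 0 ∷ []
      no-0120 {a} {b} {c} abc⊆ e with red≡0120⇒ a b c k e
      ... | k<b , b<c , refl = <⇒≱ k<b (≤-pred (<-≤-trans b<c (≤M (Sublist.lookup abc⊆ (there (there (here refl)))))))

NothingBelowAfter-snoc : ∀ {k x v} → NothingBelowAfter k x → k ≤ v → NothingBelowAfter k (x ++ [ v ])
NothingBelowAfter-snoc {k} {x} {v} k-floor k≤v kb⊆ with pair-⊆-snoc⁻ x v kb⊆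
... | inj₁ kb⊆x = k-floor kb⊆x
... | inj₂ (_ , refl) = k≤v

NothingBelowAfter-new-max : ∀ {M x} → (∀ {a} → a ∈ x → a ≤ M) → NothingBelowAfter (suc M) (x ++ [ suc M ])
NothingBelowAfter-new-max {M} {x} ≤M kb⊆ with pair-⊆-snoc⁻ x (suc M) kb⊆
... | inj₁ kb⊆x = ⊥-elim (n≮n _ (≤M (Sublist.lookup kb⊆x (here refl))))
... | inj₂ (k∈x , _) = ⊥-elim (n≮n _ (≤M k∈x))

data AscState : Set where
  sA sB sC : ℕ → AscState

maximum : AscState → ℕ
maximum (sA M) = M
maximum (sB k) = suc k
maximum (sC k) = suc k

lastLetter : AscState → ℕ
lastLetter (sA M) = M
lastLetter (sB k) = k
lastLetter (sC k) = suc k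

stateLabel : AscState → Label
stateLabel (sA _) = LA
stateLabel (sB _) = LB
stateLabel (sC _) = LC

StateSpec : List ℕ → AscState → Set
StateSpec x (sA M) = NothingBelowAfter M x × (M ≡ 0 ⊎ ∃ λ k → M ≡ suc (suc k) × suc k ∷ k ∷ [] ⊆ x)
StateSpec x (sB k) = suc k ∷ k ∷ [] ⊆ x
StateSpec x (sC k) = NothingBelowAfter (suc k) x × NothingBelowAfter k x

AscInv : List ℕ × AscState → Set
AscInv (x , σ) = Admissible (maximum σ) (lastLetter σ) x × StateSpec x σ

ascChildren : List ℕ × AscState → List (List ℕ × AscState)
ascChildren (x , sA M) = (x ++ [ M ] , sA M) ∷ (x ++ [ suc M ] , sC M) ∷ []
ascChildren (x , sB k) = (x ++ [ k ] , sB k) ∷ (x ++ [ suc (suc k) ] , sA (suc (suc k))) ∷ []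
ascChildren (x , sC k) = (x ++ [ suc k ] , sC k) ∷ (x ++ [ k ] , sB k) ∷ (x ++ [ suc (suc k) ] , sC (suc k)) ∷ []

ascChildren-label : ∀ e → map (stateLabel ∘ proj₂) (ascChildren e) ≡ children (stateLabel (proj₂ e))
ascChildren-label (x , sA M) = refl
ascChildren-label (x , sB k) = refl
ascChildren-label (x , sC k) = refl

ascLevel : ℕ → List (List ℕ × AscState)
ascLevel = grow (stateLabel ∘ proj₂) (λ _ → ascChildren) (λ _ → ascChildren-label) (([ 0 ] , sA 0) ∷ [])

ascChildren-sound : ∀ {e c} → AscInv e → c ∈ ascChildren e → AscInv c
ascChildren-sound {x , sA M} (adm , M-floor , M≡) (here refl) = repeat-last adm , NothingBelowAfter-snoc M-floor ≤-refl , M≡′ M≡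
  where
  M≡′ : (M ≡ 0 ⊎ ∃ λ k → M ≡ suc (suc k) × suc k ∷ k ∷ [] ⊆ x) →
    M ≡ 0 ⊎ ∃ λ k → M ≡ suc (suc k) × suc k ∷ k ∷ [] ⊆ x ++ [ M ]
  M≡′ (inj₁ M≡0) = inj₁ M≡0
  M≡′ (inj₂ (k , M≡ , dip⊆)) = inj₂ (k , M≡ , ++⁺ʳ [ M ] dip⊆)
ascChildren-sound {x , sA M} (adm , M-floor , _) (there (here refl)) =
  new-max adm , NothingBelowAfter-new-max (Admissible.≤M adm) , NothingBelowAfter-snoc M-floor (n≤1+n M)
ascChildren-sound {x , sB k} (adm , dip⊆) (here refl) = repeat-last adm , ++⁺ʳ [ k ] dip⊆
ascChildren-sound {x , sB k} (adm , dip⊆) (there (here refl)) =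
  new-max adm , NothingBelowAfter-new-max (Admissible.≤M adm) , inj₂ (k , refl , ++⁺ʳ [ suc (suc k) ] dip⊆)
ascChildren-sound {x , sC k} (adm , k+1-floor , k-floor) (here refl) =
  repeat-last adm , NothingBelowAfter-snoc k+1-floor ≤-refl , NothingBelowAfter-snoc k-floor (n≤1+n k)
ascChildren-sound {x , sC k} (adm , _ , k-floor) (there (here refl)) =
  dip adm k-floor , ++⁺ (from∈ (Admissible.M∈ adm)) (refl ∷ [])
ascChildren-sound {x , sC k} (adm , k+1-floor , _) (there (there (here refl))) =
  new-max adm , NothingBelowAfter-new-max (Admissible.≤M adm) , NothingBelowAfter-snoc k+1-floor (n≤1+n (suc k))

ascRoot : AscInv ([ 0 ] , sA 0)
ascRoot = record
  { init = []
  ; x≡init∷ʳℓ = refl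
  ; ascent = _
  ; asc≡M = refl
  ; ≤M = λ { (here refl) → z≤n }
  ; M∈ = here refl
  ; smaller-before = λ _ _ a<b b≤0 → ⊥-elim (n≮0 (<-≤-trans a<b b≤0))
  ; avoids₃ = ¬Occurs-singleton ∷ ¬Occurs-singleton ∷ []
  ; avoids₄ = ¬Occurs-singleton ∷ ¬Occurs-singleton ∷ []
  } , (λ _ → z≤n) , inj₁ refl

ascChildren-snoc : ∀ {x σ c} → c ∈ ascChildren (x , σ) → ∃ λ v → proj₁ c ≡ x ++ [ v ]
ascChildren-snoc {σ = sA _} (here refl) = _ , refl
ascChildren-snoc {σ = sA _} (there (here refl)) = _ , refl
ascChildren-snoc {σ = sB _} (here refl) = _ , refl
ascChildren-snoc {σ = sB _} (there (here refl)) = _ , refl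
ascChildren-snoc {σ = sC _} (here refl) = _ , refl
ascChildren-snoc {σ = sC _} (there (here refl)) = _ , refl
ascChildren-snoc {σ = sC _} (there (there (here refl))) = _ , refl

ascLevel-sound : ∀ n {e} → e ∈ ascLevel n → AscInv e × length (proj₁ e) ≡ suc n
ascLevel-sound = All-grow (stateLabel ∘ proj₂) (λ _ → ascChildren) (λ _ → ascChildren-label)
  (λ n e → AscInv e × length (proj₁ e) ≡ suc n) (λ { (here refl) → ascRoot , refl }) step
  where
  step : ∀ {n e c} → AscInv e × length (proj₁ e) ≡ suc n → c ∈ ascChildren e → AscInv c × length (proj₁ c) ≡ suc (suc n)
  step {e = x , _} (inv , len) c∈ with ascChildren-snoc c∈
  ... | v , refl = ascChildren-sound inv c∈ , trans (length-snoc x v) (cong suc len)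

ascLevel-unique : ∀ n → Unique (map proj₁ (ascLevel n))
ascLevel-unique = Unique-grow (stateLabel ∘ proj₂) (λ _ → ascChildren) (λ _ → ascChildren-label) proj₁ (λ _ _ → ⊤)
  (λ _ → tt) (λ {_} {e} _ → children-unique e) parent ([] ∷ [])
  where
  ≢-snoc : ∀ x {v w} → v ≢ w → x ++ [ v ] ≢ x ++ [ w ]
  ≢-snoc x v≢w e = v≢w (∷ʳ-injectiveʳ x x e)
  children-unique : ∀ e → Unique (map proj₁ (ascChildren e))
  children-unique (x , sA M) = (≢-snoc x (λ ()) ∷ []) ∷ [] ∷ []
  children-unique (x , sB k) = (≢-snoc x (λ ()) ∷ []) ∷ [] ∷ []
  children-unique (x , sC k) = (≢-snoc x (λ ()) ∷ ≢-snoc x (λ ()) ∷ []) ∷ (≢-snoc x (λ ()) ∷ []) ∷ [] ∷ []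
  parent : ∀ {e e′ c c′} → ⊤ → ⊤ → c ∈ ascChildren e → c′ ∈ ascChildren e′ →
    proj₁ c ≡ proj₁ c′ → proj₁ e ≡ proj₁ e′
  parent {e = x , _} {e′ = x′ , _} _ _ c∈ c′∈ c≡c′ with ascChildren-snoc c∈ | ascChildren-snoc c′∈
  ... | v , refl | v′ , refl = ∷ʳ-injectiveˡ x x′ c≡c′

ascLevel-length : ∀ n → length (map proj₁ (ascLevel n)) ≡ descendants n LA
ascLevel-length n = trans (length-map proj₁ (ascLevel n))
  (trans (length-grow (stateLabel ∘ proj₂) (λ _ → ascChildren) (λ _ → ascChildren-label) _ n) (+-identityʳ _))

NoReturn : List ℕ → ℕ → Set
NoReturn x v = ∀ {c d} → d < c → c ∷ d ∷ [] ⊆ x → v ≢ c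

NotBelowAscent : List ℕ → ℕ → Set
NotBelowAscent x v = ∀ {c e} → v < c → c < e → c ∷ e ∷ [] ⊆ x → ⊥

-- The letter v ≤ M + 1 allowed by the ascent condition (asc x = M) either labels a child, or returns to a
-- letter after a smaller one, or lies below an ascent.
ascChildren-complete : ∀ {x σ v} → AscInv (x , σ) → v ≤ suc (maximum σ) → NoReturn x v → NotBelowAscent x v →
  ∃ λ σ′ → (x ++ [ v ] , σ′) ∈ ascChildren (x , σ)
ascChildren-complete {σ = sA M} {v} (adm , _ , M≡) v≤ no-return not-below with m≤n⇒m<n∨m≡n v≤
... | inj₂ refl = sC M , there (here refl)
... | inj₁ v<1+M with m≤n⇒m<n∨m≡n (≤-pred v<1+M)
...   | inj₂ refl = sA v , here refl
...   | inj₁ v<M with M≡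
...     | inj₁ refl = ⊥-elim (n≮0 v<M)
...     | inj₂ (k , refl , dip⊆) with m≤n⇒m<n∨m≡n (≤-pred v<M)
...       | inj₂ refl = ⊥-elim (no-return (n<1+n k) dip⊆ refl)
...       | inj₁ v<k+1 = ⊥-elim (not-below v<k+1 (n<1+n _) (∷M⊆ adm (n<1+n _)))
ascChildren-complete {σ = sB k} {v} (adm , dip⊆) v≤ no-return not-below with m≤n⇒m<n∨m≡n v≤
... | inj₂ refl = sA (suc (suc k)) , there (here refl)
... | inj₁ v<k+2 with m≤n⇒m<n∨m≡n (≤-pred v<k+2)
...   | inj₂ refl = ⊥-elim (no-return (n<1+n k) dip⊆ refl)
...   | inj₁ v<k+1 with m≤n⇒m<n∨m≡n (≤-pred v<k+1)
...     | inj₂ refl = sB k , here refl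
...     | inj₁ v<k = ⊥-elim (not-below v<k (n<1+n _) (∷M⊆ adm (n<1+n _)))
ascChildren-complete {σ = sC k} {v} (adm , _) v≤ no-return not-below with m≤n⇒m<n∨m≡n v≤
... | inj₂ refl = sC (suc k) , there (there (here refl))
... | inj₁ v<k+2 with m≤n⇒m<n∨m≡n (≤-pred v<k+2)
...   | inj₂ refl = sC k , here refl
...   | inj₁ v<k+1 with m≤n⇒m<n∨m≡n (≤-pred v<k+1)
...     | inj₂ refl = sB k , there (here refl)
...     | inj₁ v<k = ⊥-elim (not-below v<k (n<1+n _) (∷M⊆ adm (n<1+n _)))

ascAvoid⁻ : ∀ P n x → T ((length x ≡ᵇ n) ∧ isAscentSeq x ∧ avoidsAll P x) → length x ≡ n × T (isAscentSeq x) × Avoids P x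
ascAvoid⁻ P n x t with T-∧⁻ {length x ≡ᵇ n} t
... | len , t′ with T-∧⁻ {isAscentSeq x} t′
...   | asc-x , av = ≡ᵇ⇒≡ _ _ len , asc-x , avoidsAll⇒Avoids P x av

ascAvoid⁺ : ∀ P n x → length x ≡ n → T (isAscentSeq x) → Avoids P x → T ((length x ≡ᵇ n) ∧ isAscentSeq x ∧ avoidsAll P x)
ascAvoid⁺ P n x len asc-x av = T-∧⁺ {length x ≡ᵇ n} (≡⇒≡ᵇ _ _ len) (T-∧⁺ {isAscentSeq x} asc-x (Avoids⇒avoidsAll P x av))

module AscentClass (P : List (List ℕ))
  (no-return : ∀ {M ℓ x v} → Admissible M ℓ x → Avoids P (x ++ [ v ]) → NoReturn x v)
  (not-below-ascent : ∀ {M ℓ x v} → Admissible M ℓ x → Avoids P (x ++ [ v ]) → NotBelowAscent x v)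
  (admissible⇒avoids : ∀ {M ℓ x} → Admissible M ℓ x → Avoids P x) where

  ascLevel-complete : ∀ n {x} → length x ≡ suc n → T (isAscentSeq x) → Avoids P x → ∃ λ σ → (x , σ) ∈ ascLevel n
  ascLevel-complete zero {y ∷ []} _ asc-y _ with ≡ᵇ⇒≡ y 0 (proj₁ (T-∧⁻ {y ≡ᵇ 0} asc-y))
  ... | refl = sA 0 , here refl
  ascLevel-complete (suc n) {x} len asc-x av with initLast x
  ascLevel-complete (suc n) {.((a ∷ r) ++ [ v ])} len asc-x av | (a ∷ r) ∷ʳ′ v
    with isAscentSeq-snoc⁻ a r v asc-x
  ... | asc-x′ , v≤
    with ascLevel-complete n (suc-injective (trans (sym (length-snoc (a ∷ r) v)) len)) asc-x′ (Avoids-⊆ (++⁺ʳ [ v ] ⊆-refl) av)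
  ...   | σ , x′∈ with ascLevel-sound n x′∈
  ...     | (adm , spec) , _
    with ascChildren-complete (adm , spec) (subst (λ m → v ≤ suc m) (Admissible.asc≡M adm) v≤)
                              (no-return adm av) (not-below-ascent adm av)
  ...       | σ′ , c∈ =
    σ′ , ∈-grow-suc (stateLabel ∘ proj₂) (λ _ → ascChildren) (λ _ → ascChildren-label) {n = n} x′∈ c∈

  ascAvoid-card : ∀ n → HasCard (AscAvoid P (suc n)) (descendants n LA)
  ascAvoid-card n = subst (λ m → AscAvoid P (suc n) ↔ Fin m) (ascLevel-length n)
    (enumeration _ (map proj₁ (ascLevel n)) (ascLevel-unique n) complete sound)
    where
    complete : ∀ {x} → T ((length x ≡ᵇ suc n) ∧ isAscentSeq x ∧ avoidsAll P x) → x ∈ map proj₁ (ascLevel n)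
    complete {x} t with ascAvoid⁻ P (suc n) x t
    ... | len , asc-x , av = ∈-map⁺ proj₁ (proj₂ (ascLevel-complete n len asc-x av))
    sound : ∀ {x} → x ∈ map proj₁ (ascLevel n) → T ((length x ≡ᵇ suc n) ∧ isAscentSeq x ∧ avoidsAll P x)
    sound x∈ with ∈-map⁻ proj₁ x∈
    ... | e , e∈ , refl with ascLevel-sound n e∈
    ...   | (adm , _) , len = ascAvoid⁺ P (suc n) _ len (Admissible.ascent adm) (admissible⇒avoids adm)

ascAvoid₃-card : ∀ n → HasCard (AscAvoid Pat₃ (suc n)) (descendants n LA)
ascAvoid₃-card = AscentClass.ascAvoid-card Pat₃ no-return not-below-ascent Admissible.avoids₃
  where
  no-return : ∀ {M ℓ x v} → Admissible M ℓ x → Avoids Pat₃ (x ++ [ v ]) → NoReturn x v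
  no-return _ (¬101 ∷ _) d<c cd⊆ refl = ¬101 (Occurs-101 d<c (++⁺ cd⊆ (refl ∷ [])))
  not-below-ascent : ∀ {M ℓ x v} → Admissible M ℓ x → Avoids Pat₃ (x ++ [ v ]) → NotBelowAscent x v
  not-below-ascent _ (_ ∷ ¬120 ∷ _) v<c c<e ce⊆ = ¬120 (Occurs-120 v<c c<e (++⁺ ce⊆ (refl ∷ [])))

ascAvoid₄-card : ∀ n → HasCard (AscAvoid Pat₄ (suc n)) (descendants n LA)
ascAvoid₄-card = AscentClass.ascAvoid-card Pat₄ no-return not-below-ascent Admissible.avoids₄
  where
  no-return : ∀ {M ℓ x v} → Admissible M ℓ x → Avoids Pat₄ (x ++ [ v ]) → NoReturn x v
  no-return adm (¬0101 ∷ _) d<c cd⊆ refl = ¬0101 (Occurs-0101 d<c (++⁺ (prepend-smaller adm cd⊆ d<c) (refl ∷ [])))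
  not-below-ascent : ∀ {M ℓ x v} → Admissible M ℓ x → Avoids Pat₄ (x ++ [ v ]) → NotBelowAscent x v
  not-below-ascent adm (_ ∷ ¬0120 ∷ _) v<c c<e ce⊆ = ¬0120 (Occurs-0120 v<c c<e (++⁺ (prepend-smaller adm ce⊆ v<c) (refl ∷ [])))

-- Permutations

split-++≡++ : ∀ (u′ w′ u w : List ℕ) → u′ ++ w′ ≡ u ++ w →
  (∃ λ t → u ≡ u′ ++ t × w′ ≡ t ++ w) ⊎ (∃ λ t → u′ ≡ u ++ t × w ≡ t ++ w′)
split-++≡++ [] w′ u w e = inj₁ (u , refl , e)
split-++≡++ (a ∷ u′) w′ [] w e = inj₂ (a ∷ u′ , refl , sym e)
split-++≡++ (a ∷ u′) w′ (b ∷ u) w e with ∷-injective e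
... | refl , e′ with split-++≡++ u′ w′ u w e′
...   | inj₁ (t , refl , w′≡) = inj₁ (t , refl , w′≡)
...   | inj₂ (t , refl , w≡) = inj₂ (t , refl , w≡)

NonEmpty : List ℕ → Set
NonEmpty w = ∃₂ λ h t → w ≡ h ∷ t

[]⊎NonEmpty : ∀ (t : List ℕ) → t ≡ [] ⊎ NonEmpty t
[]⊎NonEmpty [] = inj₁ refl
[]⊎NonEmpty (h ∷ t) = inj₂ (h , t , refl)

≢[]⇒NonEmpty : ∀ {t : List ℕ} → t ≢ [] → NonEmpty t
≢[]⇒NonEmpty {[]} t≢[] = ⊥-elim (t≢[] refl)
≢[]⇒NonEmpty {h ∷ t} _ = h , t , refl

Decreasing : List ℕ → Set
Decreasing [] = ⊤
Decreasing (h ∷ t) = (∀ {e} → e ∈ t → e < h) × Decreasing t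

AllBelow : List ℕ → List ℕ → Set
AllBelow u w = ∀ {a b} → a ∈ u → b ∈ w → a < b

Avoids123 : List ℕ → Set
Avoids123 w = ∀ {a b c} → a ∷ b ∷ c ∷ [] ⊆ w → a < b → b < c → ⊥

HasRise : List ℕ → Set
HasRise w = ∃₂ λ a b → a ∷ b ∷ [] ⊆ w × a < b

-- Inserting a new maximum between u and w creates a 231 (first case) or a 4123 (second case).
Inactive : List ℕ → List ℕ → Set
Inactive u w = (∃₂ λ a b → a ∈ u × b ∈ w × b < a) ⊎ (∃₂ λ a b → ∃ λ c → a ∷ b ∷ c ∷ [] ⊆ w × a < b × b < c)

InactiveLeftOf : List ℕ → List ℕ → Set
InactiveLeftOf u w = ∀ u₁ t → u ≡ u₁ ++ t → t ≢ [] → Inactive u₁ (t ++ w)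

InactiveInside : List ℕ → List ℕ → Set
InactiveInside u w = ∀ t₁ t₂ → w ≡ t₁ ++ t₂ → t₁ ≢ [] → t₂ ≢ [] → Inactive (u ++ t₁) t₂

Inactive-⊆ : ∀ {u w w′} → w ⊆ w′ → Inactive u w → Inactive u w′
Inactive-⊆ w⊆ (inj₁ (a , b , a∈ , b∈ , b<a)) = inj₁ (a , b , a∈ , Sublist.lookup w⊆ b∈ , b<a)
Inactive-⊆ w⊆ (inj₂ (a , b , c , abc⊆ , a<b , b<c)) = inj₂ (a , b , c , ⊆-trans abc⊆ w⊆ , a<b , b<c)

InactiveLeftOf-⊆ : ∀ {u w w′} → w ⊆ w′ → InactiveLeftOf u w → InactiveLeftOf u w′
InactiveLeftOf-⊆ w⊆ inactive u₁ t u≡ t≢[] = Inactive-⊆ (++⁺ ⊆-refl w⊆) (inactive u₁ t u≡ t≢[])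

Decreasing⇒> : ∀ {w a b} → Decreasing w → a ∷ b ∷ [] ⊆ w → b < a
Decreasing⇒> {_ ∷ _} (_ , dec) (_ ∷ʳ ab⊆) = Decreasing⇒> dec ab⊆
Decreasing⇒> {_ ∷ _} (h> , _) (refl ∷ b⊆) = h> (Sublist.lookup b⊆ (here refl))

Decreasing⇒Avoids123 : ∀ {w} → Decreasing w → Avoids123 w
Decreasing⇒Avoids123 dec abc⊆ a<b _ = n≮n _ (<-trans a<b (Decreasing⇒> dec (⊆-trans (refl ∷ refl ∷ _ ∷ʳ []) abc⊆)))

Avoids123-∷ : ∀ {m w} → (∀ {e} → e ∈ w → e < m) → Avoids123 w → Avoids123 (m ∷ w)
Avoids123-∷ w<m av (_ ∷ʳ abc⊆) = av abc⊆
Avoids123-∷ w<m av (refl ∷ bc⊆) a<b _ = n≮n _ (<-trans a<b (w<m (Sublist.lookup bc⊆ (here refl))))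

Avoids123-++ : ∀ {w₁ w₂} → Decreasing w₁ → Decreasing w₂ → Avoids123 (w₁ ++ w₂)
Avoids123-++ {w₁} dec₁ dec₂ abc⊆ a<b b<c with ⊆-split-++ w₁ abc⊆
... | [] , _ , refl , _ , abc⊆₂ = Decreasing⇒Avoids123 dec₂ abc⊆₂ a<b b<c
... | _ ∷ [] , _ , refl , _ , bc⊆₂ = n≮n _ (<-trans b<c (Decreasing⇒> dec₂ bc⊆₂))
... | _ ∷ _ ∷ r , _ , e , ab⊆₁ , _ with ∷-injective e
...   | refl , e′ with ∷-injective e′
...     | refl , _ = n≮n _ (<-trans a<b (Decreasing⇒> dec₁ (⊆-trans (refl ∷ refl ∷ minimum r) ab⊆₁)))

InactiveInside-∷ : ∀ {u m w} → (∀ {e} → e ∈ w → e < m) → InactiveInside u (m ∷ w)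
InactiveInside-∷ w<m [] _ _ t₁≢[] _ = ⊥-elim (t₁≢[] refl)
InactiveInside-∷ w<m (_ ∷ _) [] _ _ t₂≢[] = ⊥-elim (t₂≢[] refl)
InactiveInside-∷ {u} {m} w<m (_ ∷ t₁) (b ∷ t₂) e _ _ with ∷-injective e
... | refl , w≡ = inj₁ (m , b , ∈-++⁺ʳ u (here refl) , here refl , w<m (subst (b ∈_) (sym w≡) (∈-++⁺ʳ t₁ (here refl))))

AllBelow-∷ : ∀ {u m w} → (∀ {a} → a ∈ u → a < m) → AllBelow u w → AllBelow u (m ∷ w)
AllBelow-∷ u<m _ a∈ (here refl) = u<m a∈
AllBelow-∷ _ u<w a∈ (there b∈) = u<w a∈ b∈

AllBelow-++ˡ : ∀ {u₁ u₂ w} → AllBelow u₁ w → AllBelow u₂ w → AllBelow (u₁ ++ u₂) w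
AllBelow-++ˡ {u₁} u₁<w u₂<w a∈ b∈ with ∈-++⁻ u₁ a∈
... | inj₁ a∈₁ = u₁<w a∈₁ b∈
... | inj₂ a∈₂ = u₂<w a∈₂ b∈

AllBelow-++ʳ : ∀ {u w₁ w₂} → AllBelow u w₁ → AllBelow u w₂ → AllBelow u (w₁ ++ w₂)
AllBelow-++ʳ {w₁ = w₁} u<w₁ u<w₂ a∈ b∈ with ∈-++⁻ w₁ b∈
... | inj₁ b∈₁ = u<w₁ a∈ b∈₁
... | inj₂ b∈₂ = u<w₂ a∈ b∈₂

AllBelow-[] : ∀ {u} → AllBelow u []
AllBelow-[] _ ()

Avoids123-[] : Avoids123 []
Avoids123-[] ()

isPerm⁻ : ∀ n x → T (isPerm n x) → length x ≡ n × (∀ k → 1 ≤ k → k ≤ n → k ∈ x)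
isPerm⁻ n x t with T-∧⁻ {length x ≡ᵇ n} t
... | len , all-in = ≡ᵇ⇒≡ _ _ len , ∈x
  where
  ∈x : ∀ k → 1 ≤ k → k ≤ n → k ∈ x
  ∈x (suc k) _ k<n with find (any⁻ _ x (All.lookup (all⁺ _ _ all-in) (∈-applyUpTo⁺ suc k<n)))
  ... | y , y∈ , y≡ with ≡ᵇ⇒≡ y (suc k) y≡
  ...   | refl = y∈

isPerm⁺ : ∀ n x → length x ≡ n → (∀ k → 1 ≤ k → k ≤ n → k ∈ x) → T (isPerm n x)
isPerm⁺ n x len ∈x = T-∧⁺ {length x ≡ᵇ n} (≡⇒≡ᵇ _ _ len) (all⁻ _ (All.tabulate ∈x′))
  where
  ∈x′ : ∀ {k} → k ∈ applyUpTo suc n → T (any (_≡ᵇ k) x)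
  ∈x′ k∈ with ∈-applyUpTo⁻ suc k∈
  ... | i , i<n , refl = any⁺ _ (lose (∈x (suc i) (s≤s z≤n) i<n) (≡⇒≡ᵇ (suc i) (suc i) refl))

PermPat : List (List ℕ)
PermPat = (2 ∷ 3 ∷ 1 ∷ []) ∷ (4 ∷ 1 ∷ 2 ∷ 3 ∷ []) ∷ []

record AvoidingPerm (n : ℕ) (x : List ℕ) : Set where
  field
    length≡n : length x ≡ n
    ≤n       : ∀ {a} → a ∈ x → a ≤ n
    ∈x       : ∀ k → 1 ≤ k → k ≤ n → k ∈ x
    avoids   : Avoids PermPat x

module _ {n u w} (u≤n : ∀ {a} → a ∈ u → a ≤ n) (w≤n : ∀ {a} → a ∈ w → a ≤ n) where

  private
    m = suc n
    ≰n : ∀ {b} → m ≤ b → b ≤ n → ⊥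
    ≰n m≤b b≤n = n≮n _ (≤-trans m≤b b≤n)

  no-231-through-max : AllBelow u w → ∀ s₁ s₂ → s₁ ⊆ u → s₂ ⊆ w →
    red (s₁ ++ m ∷ s₂) ≡ 1 ∷ 2 ∷ 0 ∷ [] → suc (length (s₁ ++ s₂)) ≡ 3 → ⊥
  no-231-through-max _ [] (b ∷ c ∷ []) _ bc⊆ e _ = ≰n (<⇒≤ (proj₂ (red≡120⇒ m b c e))) (w≤n (Sublist.lookup bc⊆ (here refl)))
  no-231-through-max u<w (a ∷ []) (c ∷ []) a⊆ c⊆ e _ =
    n≮n _ (<-trans (proj₁ (red≡120⇒ a m c e)) (u<w (Sublist.lookup a⊆ (here refl)) (Sublist.lookup c⊆ (here refl))))
  no-231-through-max _ (a ∷ b ∷ []) [] ab⊆ _ e _ = ≰n (<⇒≤ (proj₁ (red≡120⇒ a b m e))) (u≤n (Sublist.lookup ab⊆ (here refl)))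
  no-231-through-max _ [] [] _ _ _ ()
  no-231-through-max _ [] (_ ∷ []) _ _ _ ()
  no-231-through-max _ [] (_ ∷ _ ∷ _ ∷ _) _ _ _ ()
  no-231-through-max _ (_ ∷ []) [] _ _ _ ()
  no-231-through-max _ (_ ∷ []) (_ ∷ _ ∷ _) _ _ _ ()
  no-231-through-max _ (_ ∷ _ ∷ []) (_ ∷ _) _ _ _ ()
  no-231-through-max _ (_ ∷ _ ∷ _ ∷ _) _ _ _ _ ()

  no-4123-through-max : Avoids123 w → ∀ s₁ s₂ → s₁ ⊆ u → s₂ ⊆ w →
    red (s₁ ++ m ∷ s₂) ≡ 3 ∷ 0 ∷ 1 ∷ 2 ∷ [] → suc (length (s₁ ++ s₂)) ≡ 4 → ⊥
  no-4123-through-max w-123 [] (a ∷ b ∷ c ∷ []) _ abc⊆ e _ with red≡3012⇒ m a b c e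
  ... | a<b , b<c , _ = w-123 abc⊆ a<b b<c
  no-4123-through-max _ (a ∷ []) (b ∷ c ∷ []) _ bc⊆ e _ =
    ≰n (<⇒≤ (proj₁ (red≡3012⇒ a m b c e))) (w≤n (Sublist.lookup bc⊆ (here refl)))
  no-4123-through-max _ (a ∷ b ∷ []) (c ∷ []) _ c⊆ e _ =
    ≰n (<⇒≤ (proj₁ (proj₂ (red≡3012⇒ a b m c e)))) (w≤n (Sublist.lookup c⊆ (here refl)))
  no-4123-through-max _ (a ∷ b ∷ c ∷ []) [] abc⊆ _ e _ =
    ≰n (<⇒≤ (proj₂ (proj₂ (red≡3012⇒ a b c m e)))) (u≤n (Sublist.lookup abc⊆ (here refl)))
  no-4123-through-max _ [] [] _ _ _ ()
  no-4123-through-max _ [] (_ ∷ []) _ _ _ ()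
  no-4123-through-max _ [] (_ ∷ _ ∷ []) _ _ _ ()
  no-4123-through-max _ [] (_ ∷ _ ∷ _ ∷ _ ∷ _) _ _ _ ()
  no-4123-through-max _ (_ ∷ []) [] _ _ _ ()
  no-4123-through-max _ (_ ∷ []) (_ ∷ []) _ _ _ ()
  no-4123-through-max _ (_ ∷ []) (_ ∷ _ ∷ _ ∷ _) _ _ _ ()
  no-4123-through-max _ (_ ∷ _ ∷ []) [] _ _ _ ()
  no-4123-through-max _ (_ ∷ _ ∷ []) (_ ∷ _ ∷ _) _ _ _ ()
  no-4123-through-max _ (_ ∷ _ ∷ _ ∷ []) (_ ∷ _) _ _ _ ()
  no-4123-through-max _ (_ ∷ _ ∷ _ ∷ _ ∷ _) _ _ _ _ ()

Avoids-insert-max : ∀ n u w → Avoids PermPat (u ++ w) → (∀ {a} → a ∈ u ++ w → a ≤ n) → AllBelow u w → Avoids123 w →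
  Avoids PermPat (u ++ suc n ∷ w)
Avoids-insert-max n u w (¬231 ∷ ¬4123 ∷ []) ≤n u<w w-123 = ¬231′ ∷ ¬4123′ ∷ []
  where
  ¬231′ : ¬ Occurs (1 ∷ 2 ∷ 0 ∷ []) (u ++ suc n ∷ w)
  ¬231′ occ with Occurs-insert⁻ u (suc n) w occ
  ... | inj₁ occ′ = ¬231 occ′
  ... | inj₂ (s₁ , s₂ , s₁⊆ , s₂⊆ , e , len) = no-231-through-max (≤n ∘ ∈-++⁺ˡ) (≤n ∘ ∈-++⁺ʳ u) u<w s₁ s₂ s₁⊆ s₂⊆ e len
  ¬4123′ : ¬ Occurs (3 ∷ 0 ∷ 1 ∷ 2 ∷ []) (u ++ suc n ∷ w)
  ¬4123′ occ with Occurs-insert⁻ u (suc n) w occ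
  ... | inj₁ occ′ = ¬4123 occ′
  ... | inj₂ (s₁ , s₂ , s₁⊆ , s₂⊆ , e , len) = no-4123-through-max (≤n ∘ ∈-++⁺ˡ) (≤n ∘ ∈-++⁺ʳ u) w-123 s₁ s₂ s₁⊆ s₂⊆ e len

insert-max : ∀ {n} u w → AvoidingPerm n (u ++ w) → AllBelow u w → Avoids123 w → AvoidingPerm (suc n) (u ++ suc n ∷ w)
insert-max {n} u w π u<w w-123 = record
  { length≡n = trans (length-++-sucʳ u (suc n) w) (cong suc length≡n)
  ; ≤n = ≤1+n
  ; ∈x = ∈x′
  ; avoids = Avoids-insert-max n u w avoids ≤n u<w w-123
  }
  where
  open AvoidingPerm π
  ≤1+n : ∀ {a} → a ∈ u ++ suc n ∷ w → a ≤ suc n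
  ≤1+n a∈ with ∈-++⁻ u a∈
  ... | inj₁ a∈u = m≤n⇒m≤1+n (≤n (∈-++⁺ˡ a∈u))
  ... | inj₂ (here refl) = ≤-refl
  ... | inj₂ (there a∈w) = m≤n⇒m≤1+n (≤n (∈-++⁺ʳ u a∈w))
  ∈x′ : ∀ k → 1 ≤ k → k ≤ suc n → k ∈ u ++ suc n ∷ w
  ∈x′ k 1≤k k≤1+n with m≤n⇒m<n∨m≡n k≤1+n
  ... | inj₂ refl = ∈-++⁺ʳ u (here refl)
  ... | inj₁ k<1+n = Sublist.lookup (⊆-insert u (suc n) w) (∈x k 1≤k (≤-pred k<1+n))

Inactive-rise : ∀ {v w a b m} → a ∷ b ∷ [] ⊆ w → a < b → b < m → Inactive v (w ++ [ m ])
Inactive-rise ab⊆ a<b b<m = inj₂ (_ , _ , _ , ++⁺ ab⊆ (refl ∷ []) , a<b , b<m)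

Inactive-heads-rise : ∀ {v h₁ t₁ h₂ t₂ m} → h₁ < h₂ → h₂ < m → Inactive v ((h₁ ∷ t₁) ++ (h₂ ∷ t₂) ++ [ m ])
Inactive-heads-rise {t₁ = t₁} {t₂ = t₂} h₁<h₂ h₂<m = inj₂ (_ , _ , _ , refl ∷ ++⁺ˡ t₁ (refl ∷ ++⁺ˡ t₂ (refl ∷ [])) , h₁<h₂ , h₂<m)

InactiveLeftOf-close-B : ∀ {u w m} → InactiveLeftOf u w → InactiveInside u w → HasRise w → (∀ {a} → a ∈ w → a < m) →
  InactiveLeftOf (u ++ w) [ m ]
InactiveLeftOf-close-B {u} {w} {m} left inside (a , b , ab⊆ , a<b) w<m u₁ t e t≢[] with split-++≡++ u₁ t u w (sym e)
... | inj₁ (r , u≡ , t≡) with []⊎NonEmpty r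
...   | inj₁ refl rewrite t≡ | ++-identityʳ u₁ | u≡ =
  Inactive-rise ab⊆ a<b (w<m (Sublist.lookup ab⊆ (there (here refl))))
...   | inj₂ (h , r′ , refl) rewrite t≡ = Inactive-⊆ (++⁺ʳ [ m ] ⊆-refl) (left u₁ (h ∷ r′) u≡ (λ ()))
InactiveLeftOf-close-B {u} {w} {m} left inside (a , b , ab⊆ , a<b) w<m u₁ t e t≢[] | inj₂ (r , u₁≡ , w≡) with []⊎NonEmpty r
... | inj₁ refl rewrite u₁≡ | w≡ | ++-identityʳ u =
  Inactive-rise ab⊆ a<b (w<m (Sublist.lookup ab⊆ (there (here refl))))
... | inj₂ (h , r′ , refl) rewrite u₁≡ = Inactive-⊆ (++⁺ʳ [ m ] ⊆-refl) (inside (h ∷ r′) t w≡ (λ ()) t≢[])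

InactiveLeftOf-close-C : ∀ {u w₁ w₂ m} → InactiveLeftOf u (w₁ ++ w₂) → Decreasing w₁ → AllBelow w₁ w₂ →
  NonEmpty w₁ → NonEmpty w₂ → (∀ {a} → a ∈ w₂ → a < m) → InactiveLeftOf (u ++ w₁) (w₂ ++ [ m ])
InactiveLeftOf-close-C {u} {m = m} left dec w₁<w₂ (h₁ , t₁ , refl) (h₂ , t₂ , refl) w₂<m u₁ t e t≢[]
  with split-++≡++ u₁ t u (h₁ ∷ t₁) (sym e)
... | inj₁ (r , u≡ , t≡) with []⊎NonEmpty r
...   | inj₁ refl rewrite t≡ | ++-identityʳ u₁ | u≡ = Inactive-heads-rise (w₁<w₂ (here refl) (here refl)) (w₂<m (here refl))
...   | inj₂ (h , r′ , refl) rewrite t≡ | ++-assoc (h ∷ r′) (h₁ ∷ t₁) ((h₂ ∷ t₂) ++ [ m ]) =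
  Inactive-⊆ (++⁺ (⊆-refl {x = h ∷ r′}) (++⁺ (⊆-refl {x = h₁ ∷ t₁}) (++⁺ʳ [ m ] (⊆-refl {x = h₂ ∷ t₂})))) (left u₁ (h ∷ r′) u≡ (λ ()))
InactiveLeftOf-close-C {u} {m = m} left dec w₁<w₂ (h₁ , t₁ , refl) (h₂ , t₂ , refl) w₂<m u₁ t e t≢[]
  | inj₂ (r , u₁≡ , w₁≡) with []⊎NonEmpty r
... | inj₁ refl rewrite u₁≡ | sym w₁≡ | ++-identityʳ u = Inactive-heads-rise (w₁<w₂ (here refl) (here refl)) (w₂<m (here refl))
... | inj₂ (h , r′ , refl) with ≢[]⇒NonEmpty t≢[]
...   | c , t′ , refl with ∷-injective w₁≡
...     | refl , t₁≡ rewrite u₁≡ =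
  inj₁ (h , c , ∈-++⁺ʳ u (here refl) , here refl , proj₁ dec (subst (c ∈_) (sym t₁≡) (∈-++⁺ʳ r′ (here refl))))

data PermState : Set where
  pA pB : List ℕ → List ℕ → PermState
  pC : List ℕ → List ℕ → List ℕ → PermState

permLabel : PermState → Label
permLabel (pA _ _) = LA
permLabel (pB _ _) = LB
permLabel (pC _ _ _) = LC

PermSpec : List ℕ → PermState → Set
PermSpec x (pA u w) = x ≡ u ++ w × NonEmpty w × Decreasing w × AllBelow u w × InactiveLeftOf u w
PermSpec x (pB u w) = x ≡ u ++ w × NonEmpty w × AllBelow u w × Avoids123 w × HasRise w × InactiveLeftOf u w × InactiveInside u w
PermSpec x (pC u w₁ w₂) = x ≡ u ++ w₁ ++ w₂ × NonEmpty w₁ × NonEmpty w₂ × Decreasing w₁ × Decreasing w₂ ×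
  AllBelow u w₁ × AllBelow u w₂ × AllBelow w₁ w₂ × InactiveLeftOf u (w₁ ++ w₂)

permChildren : ℕ → List ℕ × PermState → List (List ℕ × PermState)
permChildren m (x , pA u w) = (u ++ m ∷ w , pA u (m ∷ w)) ∷ (u ++ w ++ [ m ] , pC u w [ m ]) ∷ []
permChildren m (x , pB u w) = (u ++ m ∷ w , pB u (m ∷ w)) ∷ (x ++ [ m ] , pA x [ m ]) ∷ []
permChildren m (x , pC u w₁ w₂) =
  (u ++ w₁ ++ m ∷ w₂ , pC u w₁ (m ∷ w₂)) ∷ (u ++ m ∷ (w₁ ++ w₂) , pB u (m ∷ (w₁ ++ w₂)))
  ∷ ((u ++ w₁) ++ w₂ ++ [ m ] , pC (u ++ w₁) w₂ [ m ]) ∷ []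

permChildren-label : ∀ m e → map (permLabel ∘ proj₂) (permChildren m e) ≡ children (permLabel (proj₂ e))
permChildren-label m (x , pA u w) = refl
permChildren-label m (x , pB u w) = refl
permChildren-label m (x , pC u w₁ w₂) = refl

permLevel : ℕ → List (List ℕ × PermState)
permLevel = grow (permLabel ∘ proj₂) (permChildren ∘ suc ∘ suc) (permChildren-label ∘ suc ∘ suc) (([ 1 ] , pA [] [ 1 ]) ∷ [])

PermInv : ℕ → List ℕ × PermState → Set
PermInv n (x , σ) = AvoidingPerm (suc n) x × PermSpec x σ

append-max : ∀ {n} x → AvoidingPerm n x → AvoidingPerm (suc n) (x ++ [ suc n ])
append-max {n} x π = insert-max x [] (subst (AvoidingPerm n) (sym (++-identityʳ x)) π) AllBelow-[] Avoids123-[]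

module _ {n x} (π : AvoidingPerm n x) where

  private
    m = suc n
    <m : ∀ {a} → a ∈ x → a < m
    <m = s≤s ∘ AvoidingPerm.≤n π

  Sound : PermState → Set
  Sound σ = ∀ {c} → c ∈ permChildren m (x , σ) → AvoidingPerm m (proj₁ c) × PermSpec (proj₁ c) (proj₂ c)

  sound-pA : ∀ {u w} → PermSpec x (pA u w) → Sound (pA u w)
  sound-pA {u} {w} (refl , w-ne , dec , u<w , left) (here refl) =
    insert-max u w π u<w (Decreasing⇒Avoids123 dec) ,
    refl , (m , w , refl) , ((<m ∘ ∈-++⁺ʳ u) , dec) , AllBelow-∷ (<m ∘ ∈-++⁺ˡ) u<w , InactiveLeftOf-⊆ (m ∷ʳ ⊆-refl) left
  sound-pA {u} {w} (refl , w-ne , dec , u<w , left) (there (here refl)) =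
    subst (AvoidingPerm m) (++-assoc u w [ m ]) (append-max (u ++ w) π) ,
    refl , w-ne , (m , [] , refl) , dec , ((λ ()) , tt) , u<w , AllBelow-∷ (<m ∘ ∈-++⁺ˡ) AllBelow-[] ,
    AllBelow-∷ (<m ∘ ∈-++⁺ʳ u) AllBelow-[] , InactiveLeftOf-⊆ (++⁺ʳ [ m ] ⊆-refl) left

  sound-pB : ∀ {u w} → PermSpec x (pB u w) → Sound (pB u w)
  sound-pB {u} {w} (refl , _ , u<w , w-123 , (a , b , ab⊆ , a<b) , left , _) (here refl) =
    insert-max u w π u<w w-123 ,
    refl , (m , w , refl) , AllBelow-∷ (<m ∘ ∈-++⁺ˡ) u<w , Avoids123-∷ (<m ∘ ∈-++⁺ʳ u) w-123 , (a , b , m ∷ʳ ab⊆ , a<b) ,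
    InactiveLeftOf-⊆ (m ∷ʳ ⊆-refl) left , InactiveInside-∷ (<m ∘ ∈-++⁺ʳ u)
  sound-pB {u} {w} (refl , _ , _ , _ , rise , left , inside) (there (here refl)) =
    append-max x π ,
    refl , (m , [] , refl) , ((λ ()) , tt) , AllBelow-∷ <m AllBelow-[] , InactiveLeftOf-close-B left inside rise (<m ∘ ∈-++⁺ʳ u)

  sound-pC : ∀ {u w₁ w₂} → PermSpec x (pC u w₁ w₂) → Sound (pC u w₁ w₂)
  sound-pC {u} {w₁} {w₂} (refl , w₁-ne , w₂-ne , dec₁ , dec₂ , u<w₁ , u<w₂ , w₁<w₂ , left) (here refl) =
    subst (AvoidingPerm m) (++-assoc u w₁ (m ∷ w₂))
      (insert-max (u ++ w₁) w₂ (subst (AvoidingPerm n) (sym (++-assoc u w₁ w₂)) π) (AllBelow-++ˡ u<w₂ w₁<w₂) (Decreasing⇒Avoids123 dec₂)) ,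
    refl , w₁-ne , (m , w₂ , refl) , dec₁ , ((<m ∘ ∈-++⁺ʳ u ∘ ∈-++⁺ʳ w₁) , dec₂) , u<w₁ , AllBelow-∷ (<m ∘ ∈-++⁺ˡ) u<w₂ ,
    AllBelow-∷ (<m ∘ ∈-++⁺ʳ u ∘ ∈-++⁺ˡ) w₁<w₂ , InactiveLeftOf-⊆ (⊆-insert w₁ m w₂) left
  sound-pC {u} {_} {w₂} (refl , (h₁ , t₁ , refl) , (h₂ , t₂ , refl) , dec₁ , dec₂ , u<w₁ , u<w₂ , w₁<w₂ , left) (there (here refl)) =
    insert-max u _ π (AllBelow-++ʳ u<w₁ u<w₂) (Avoids123-++ dec₁ dec₂) ,
    refl , (m , _ , refl) , AllBelow-∷ (<m ∘ ∈-++⁺ˡ) (AllBelow-++ʳ u<w₁ u<w₂) , Avoids123-∷ (<m ∘ ∈-++⁺ʳ u) (Avoids123-++ dec₁ dec₂) ,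
    (h₁ , h₂ , m ∷ʳ (refl ∷ ++⁺ˡ t₁ (refl ∷ minimum t₂)) , w₁<w₂ (here refl) (here refl)) ,
    InactiveLeftOf-⊆ (m ∷ʳ ⊆-refl) left , InactiveInside-∷ (<m ∘ ∈-++⁺ʳ u)
  sound-pC {u} {w₁} {w₂} (refl , w₁-ne , w₂-ne , dec₁ , dec₂ , u<w₁ , u<w₂ , w₁<w₂ , left) (there (there (here refl))) =
    subst (AvoidingPerm m) (++-assoc (u ++ w₁) w₂ [ m ]) (append-max _ (subst (AvoidingPerm n) (sym (++-assoc u w₁ w₂)) π)) ,
    refl , w₂-ne , (m , [] , refl) , dec₂ , ((λ ()) , tt) , AllBelow-++ˡ u<w₂ w₁<w₂ ,
    AllBelow-∷ (<m ∘ subst (_ ∈_) (++-assoc u w₁ w₂) ∘ ∈-++⁺ˡ) AllBelow-[] , AllBelow-∷ (<m ∘ ∈-++⁺ʳ u ∘ ∈-++⁺ʳ w₁) AllBelow-[] ,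
    InactiveLeftOf-close-C left dec₁ w₁<w₂ w₁-ne w₂-ne (<m ∘ ∈-++⁺ʳ u ∘ ∈-++⁺ʳ w₁)

  permChildren-sound : ∀ {σ} → PermSpec x σ → Sound σ
  permChildren-sound {pA _ _} = sound-pA
  permChildren-sound {pB _ _} = sound-pB
  permChildren-sound {pC _ _ _} = sound-pC

permRoot : PermInv 0 ([ 1 ] , pA [] [ 1 ])
permRoot = record
  { length≡n = refl
  ; ≤n = λ { (here refl) → ≤-refl }
  ; ∈x = λ k 1≤k k≤1 → subst (_∈ [ 1 ]) (≤-antisym 1≤k k≤1) (here refl)
  ; avoids = ¬Occurs-singleton ∷ ¬Occurs-singleton ∷ []
  } , refl , (1 , [] , refl) , ((λ ()) , tt) , (λ ()) , left
  where
  left : InactiveLeftOf [] [ 1 ]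
  left [] [] _ t≢[] = ⊥-elim (t≢[] refl)

permLevel-sound : ∀ n {e} → e ∈ permLevel n → PermInv n e
permLevel-sound = All-grow (permLabel ∘ proj₂) (permChildren ∘ suc ∘ suc) (permChildren-label ∘ suc ∘ suc)
  PermInv (λ { (here refl) → permRoot }) (λ (π , spec) → permChildren-sound π spec)

Cut : ℕ → List ℕ × PermState → List ℕ → List ℕ → Set
Cut m e u′ w′ = Inactive u′ w′ ⊎ ∃ λ c → c ∈ permChildren m e × proj₁ c ≡ u′ ++ m ∷ w′

module _ (m : ℕ) {x} (u′ w′ : List ℕ) (x≡ : x ≡ u′ ++ w′) where

  cut-pA : ∀ {u w} → PermSpec x (pA u w) → Cut m (x , pA u w) u′ w′
  cut-pA {u} (refl , (h , t , refl) , dec , _ , left) with split-++≡++ u′ w′ u (h ∷ t) (sym x≡)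
  ... | inj₁ (r , refl , refl) with []⊎NonEmpty r
  ...   | inj₁ refl rewrite ++-identityʳ u′ = inj₂ (_ , here refl , refl)
  ...   | inj₂ (c , r′ , refl) = inj₁ (left u′ (c ∷ r′) refl (λ ()))
  cut-pA {u} (refl , (h , t , refl) , dec , _ , left) | inj₂ (r , refl , w≡) with []⊎NonEmpty r | []⊎NonEmpty w′
  ... | inj₁ refl | _ rewrite ++-identityʳ u | w≡ = inj₂ (_ , here refl , refl)
  ... | inj₂ (c , r′ , refl) | inj₁ refl =
    inj₂ (_ , there (here refl) , trans (cong (λ z → u ++ z ++ [ m ]) (trans w≡ (++-identityʳ (c ∷ r′)))) (sym (++-assoc u (c ∷ r′) [ m ])))
  ... | inj₂ (c , r′ , refl) | inj₂ (d , w″ , refl) with ∷-injective w≡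
  ...   | refl , t≡ = inj₁ (inj₁ (c , d , ∈-++⁺ʳ u (here refl) , here refl , proj₁ dec (subst (d ∈_) (sym t≡) (∈-++⁺ʳ r′ (here refl)))))

  cut-pB : ∀ {u w} → PermSpec x (pB u w) → Cut m (x , pB u w) u′ w′
  cut-pB {u} (refl , (h , t , refl) , _ , _ , _ , left , inside) with split-++≡++ u′ w′ u (h ∷ t) (sym x≡)
  ... | inj₁ (r , refl , refl) with []⊎NonEmpty r
  ...   | inj₁ refl rewrite ++-identityʳ u′ = inj₂ (_ , here refl , refl)
  ...   | inj₂ (c , r′ , refl) = inj₁ (left u′ (c ∷ r′) refl (λ ()))
  cut-pB {u} (refl , (h , t , refl) , _ , _ , _ , left , inside) | inj₂ (r , refl , w≡) with []⊎NonEmpty r | []⊎NonEmpty w′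
  ... | inj₁ refl | _ rewrite ++-identityʳ u | w≡ = inj₂ (_ , here refl , refl)
  ... | inj₂ (c , r′ , refl) | inj₂ (d , w″ , refl) = inj₁ (inside (c ∷ r′) (d ∷ w″) w≡ (λ ()) (λ ()))
  ... | inj₂ (c , r′ , refl) | inj₁ refl =
    inj₂ (_ , there (here refl) , cong (λ z → (u ++ z) ++ [ m ]) (trans w≡ (++-identityʳ (c ∷ r′))))

  cut-pC : ∀ {u w₁ w₂} → PermSpec x (pC u w₁ w₂) → Cut m (x , pC u w₁ w₂) u′ w′
  cut-pC {u} {_} {w₂} (refl , (h₁ , t₁ , refl) , (h₂ , t₂ , refl) , dec₁ , dec₂ , _ , _ , _ , left)
    with split-++≡++ u′ w′ u ((h₁ ∷ t₁) ++ w₂) (sym x≡)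
  ... | inj₁ (r , refl , refl) with []⊎NonEmpty r
  ...   | inj₁ refl rewrite ++-identityʳ u′ = inj₂ (_ , there (here refl) , refl)
  ...   | inj₂ (c , r′ , refl) = inj₁ (left u′ (c ∷ r′) refl (λ ()))
  cut-pC {u} {_} {w₂} (refl , (h₁ , t₁ , refl) , (h₂ , t₂ , refl) , dec₁ , dec₂ , _ , _ , _ , left) | inj₂ (r , refl , w≡)
    with []⊎NonEmpty r
  ... | inj₁ refl rewrite ++-identityʳ u | w≡ = inj₂ (_ , there (here refl) , refl)
  ... | inj₂ (c , r′ , refl) with split-++≡++ (c ∷ r′) w′ (h₁ ∷ t₁) w₂ (sym w≡)
  ...   | inj₁ (r₂ , t₁≡ , refl) with []⊎NonEmpty r₂
  ...     | inj₁ refl = inj₂ (_ , here refl ,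
              trans (cong (λ z → u ++ z ++ m ∷ w₂) (trans t₁≡ (++-identityʳ (c ∷ r′)))) (sym (++-assoc u (c ∷ r′) (m ∷ w₂))))
  ...     | inj₂ (d , r₂′ , refl) with ∷-injective t₁≡
  ...       | refl , t₁≡′ = inj₁ (inj₁ (c , d , ∈-++⁺ʳ u (here refl) , here refl , proj₁ dec₁ (subst (d ∈_) (sym t₁≡′) (∈-++⁺ʳ r′ (here refl)))))
  cut-pC {u} {_} {w₂} (refl , (h₁ , t₁ , refl) , (h₂ , t₂ , refl) , dec₁ , dec₂ , _ , _ , _ , left) | inj₂ (r , refl , w≡)
    | inj₂ (c , r′ , refl) | inj₂ (r₂ , refl , w₂≡) with []⊎NonEmpty r₂ | []⊎NonEmpty w′
  ... | inj₁ refl | _ rewrite ++-identityʳ (h₁ ∷ t₁) | w₂≡ = inj₂ (_ , here refl , sym (++-assoc u (h₁ ∷ t₁) (m ∷ w′)))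
  ... | inj₂ (d , r₂′ , refl) | inj₁ refl = inj₂ (_ , there (there (here refl)) , (begin
    (u ++ h₁ ∷ t₁) ++ w₂ ++ [ m ]              ≡⟨ cong (λ z → (u ++ h₁ ∷ t₁) ++ z ++ [ m ]) (trans w₂≡ (++-identityʳ (d ∷ r₂′))) ⟩
    (u ++ h₁ ∷ t₁) ++ (d ∷ r₂′) ++ [ m ]       ≡⟨ ++-assoc u (h₁ ∷ t₁) _ ⟩
    u ++ (h₁ ∷ t₁) ++ (d ∷ r₂′) ++ [ m ]       ≡⟨ cong (u ++_) (sym (++-assoc (h₁ ∷ t₁) (d ∷ r₂′) [ m ])) ⟩
    u ++ ((h₁ ∷ t₁) ++ d ∷ r₂′) ++ [ m ]       ≡⟨ sym (++-assoc u ((h₁ ∷ t₁) ++ d ∷ r₂′) [ m ]) ⟩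
    (u ++ (h₁ ∷ t₁) ++ d ∷ r₂′) ++ [ m ]       ∎))
    where open ≡-Reasoning
  ... | inj₂ (d , r₂′ , refl) | inj₂ (f , w″ , refl) with ∷-injective w₂≡
  ...   | refl , t₂≡ = inj₁ (inj₁ (d , f , ∈-++⁺ʳ u (∈-++⁺ʳ (h₁ ∷ t₁) (here refl)) , here refl ,
                         proj₁ dec₂ (subst (f ∈_) (sym t₂≡) (∈-++⁺ʳ r₂′ (here refl)))))

permChildren-cut : ∀ m {x σ} u′ w′ → x ≡ u′ ++ w′ → PermSpec x σ → Cut m (x , σ) u′ w′
permChildren-cut m {σ = pA _ _} u′ w′ x≡ = cut-pA m u′ w′ x≡
permChildren-cut m {σ = pB _ _} u′ w′ x≡ = cut-pB m u′ w′ x≡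
permChildren-cut m {σ = pC _ _ _} u′ w′ x≡ = cut-pC m u′ w′ x≡

permChildren-insert : ∀ m {x σ c} → PermSpec x σ → c ∈ permChildren m (x , σ) →
  ∃₂ λ u′ w′ → proj₁ c ≡ u′ ++ m ∷ w′ × x ≡ u′ ++ w′
permChildren-insert m {σ = pA u w} (x≡ , _) (here refl) = u , w , refl , x≡
permChildren-insert m {σ = pA u w} (x≡ , _) (there (here refl)) = u ++ w , [] , sym (++-assoc u w [ m ]) , trans x≡ (sym (++-identityʳ _))
permChildren-insert m {x} {pB u w} (x≡ , _) (here refl) = u , w , refl , x≡
permChildren-insert m {x} {pB u w} (x≡ , _) (there (here refl)) = x , [] , refl , sym (++-identityʳ _)
permChildren-insert m {σ = pC u w₁ w₂} (x≡ , _) (here refl) =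
  u ++ w₁ , w₂ , sym (++-assoc u w₁ (m ∷ w₂)) , trans x≡ (sym (++-assoc u w₁ w₂))
permChildren-insert m {σ = pC u w₁ w₂} (x≡ , _) (there (here refl)) = u , w₁ ++ w₂ , refl , x≡
permChildren-insert m {σ = pC u w₁ w₂} (x≡ , _) (there (there (here refl))) =
  (u ++ w₁) ++ w₂ , [] , sym (++-assoc (u ++ w₁) w₂ [ m ]) , trans x≡ (trans (sym (++-assoc u w₁ w₂)) (sym (++-identityʳ _)))

insert-injective : ∀ m (u₁ u₂ : List ℕ) {w₁ w₂} → m ∉ u₁ → m ∉ u₂ →
  u₁ ++ m ∷ w₁ ≡ u₂ ++ m ∷ w₂ → u₁ ≡ u₂ × w₁ ≡ w₂
insert-injective m [] [] _ _ e = refl , proj₂ (∷-injective e)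
insert-injective m [] (b ∷ u₂) _ m∉u₂ e with ∷-injective e
... | refl , _ = ⊥-elim (m∉u₂ (here refl))
insert-injective m (a ∷ u₁) [] m∉u₁ _ e with ∷-injective e
... | refl , _ = ⊥-elim (m∉u₁ (here refl))
insert-injective m (a ∷ u₁) (b ∷ u₂) m∉u₁ m∉u₂ e with ∷-injective e
... | refl , e′ with insert-injective m u₁ u₂ (m∉u₁ ∘ there) (m∉u₂ ∘ there) e′
...   | refl , w≡ = refl , w≡

≢++NonEmpty : ∀ (u w : List ℕ) → NonEmpty w → u ≢ u ++ w
≢++NonEmpty u w (h , t , refl) e with ++-identityʳ-unique u e
... | ()

module _ {n x} (π : AvoidingPerm n x) where

  private
    m = suc n

  max∉ : ∀ {u′ w′} → x ≡ u′ ++ w′ → m ∉ u′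
  max∉ x≡ m∈ = n≮n _ (AvoidingPerm.≤n π (subst (m ∈_) (sym x≡) (∈-++⁺ˡ m∈)))

  insert-≢ : ∀ {u₁ w₁ u₂ w₂} → x ≡ u₁ ++ w₁ → x ≡ u₂ ++ w₂ → u₁ ≢ u₂ → u₁ ++ m ∷ w₁ ≢ u₂ ++ m ∷ w₂
  insert-≢ {u₁} {_} {u₂} x≡₁ x≡₂ u₁≢u₂ e = u₁≢u₂ (proj₁ (insert-injective m u₁ u₂ (max∉ x≡₁) (max∉ x≡₂) e))

  permChildren-unique : ∀ {σ} → PermSpec x σ → Unique (map proj₁ (permChildren m (x , σ)))
  permChildren-unique {pA u w} (x≡ , w-ne , _) =
    (insert-≢ x≡ (trans x≡ (sym (++-identityʳ _))) (≢++NonEmpty u w w-ne) ∘ (λ e → trans e (sym (++-assoc u w [ m ]))) ∷ [])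
    ∷ [] ∷ []
  permChildren-unique {pB u w} (x≡ , w-ne , _) =
    (insert-≢ x≡ (sym (++-identityʳ _)) (λ u≡x → ≢++NonEmpty u w w-ne (trans u≡x x≡)) ∷ []) ∷ [] ∷ []
  permChildren-unique {pC u w₁ w₂} (x≡ , (h₁ , t₁ , refl) , w₂-ne , _) =
    (c₁≢c₂ ∷ c₁≢c₃ ∷ []) ∷ (c₂≢c₃ ∷ []) ∷ [] ∷ []
    where
    x≡′ : x ≡ (u ++ h₁ ∷ t₁) ++ w₂
    x≡′ = trans x≡ (sym (++-assoc u (h₁ ∷ t₁) w₂))
    x≡″ : x ≡ ((u ++ h₁ ∷ t₁) ++ w₂) ++ []
    x≡″ = trans x≡′ (sym (++-identityʳ _))
    c₁≢c₂ : u ++ (h₁ ∷ t₁) ++ m ∷ w₂ ≢ u ++ m ∷ (h₁ ∷ t₁) ++ w₂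
    c₁≢c₂ e = insert-≢ x≡′ x≡ (λ u≡ → ≢++NonEmpty u (h₁ ∷ t₁) (h₁ , t₁ , refl) (sym u≡)) (trans (++-assoc u (h₁ ∷ t₁) (m ∷ w₂)) e)
    c₁≢c₃ : u ++ (h₁ ∷ t₁) ++ m ∷ w₂ ≢ (u ++ h₁ ∷ t₁) ++ w₂ ++ [ m ]
    c₁≢c₃ e = insert-≢ x≡′ x≡″ (≢++NonEmpty (u ++ h₁ ∷ t₁) w₂ w₂-ne)
      (trans (++-assoc u (h₁ ∷ t₁) (m ∷ w₂)) (trans e (sym (++-assoc (u ++ h₁ ∷ t₁) w₂ [ m ]))))
    c₂≢c₃ : u ++ m ∷ (h₁ ∷ t₁) ++ w₂ ≢ (u ++ h₁ ∷ t₁) ++ w₂ ++ [ m ]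
    c₂≢c₃ e = insert-≢ x≡ x≡″ (λ u≡ → ≢++NonEmpty u ((h₁ ∷ t₁) ++ w₂) (h₁ , t₁ ++ w₂ , refl) (trans u≡ (++-assoc u (h₁ ∷ t₁) w₂)))
      (trans e (sym (++-assoc (u ++ h₁ ∷ t₁) w₂ [ m ])))

permLevel-unique : ∀ n → Unique (map proj₁ (permLevel n))
permLevel-unique = Unique-grow (permLabel ∘ proj₂) (permChildren ∘ suc ∘ suc) (permChildren-label ∘ suc ∘ suc) proj₁ PermInv
  (permLevel-sound _) (λ (π , spec) → permChildren-unique π spec) parent ([] ∷ [])
  where
  parent : ∀ {n e e′ c c′} → PermInv n e → PermInv n e′ → c ∈ permChildren (suc (suc n)) e →
    c′ ∈ permChildren (suc (suc n)) e′ → proj₁ c ≡ proj₁ c′ → proj₁ e ≡ proj₁ e′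
  parent {n} (π , spec) (π′ , spec′) c∈ c′∈ c≡c′ with permChildren-insert _ spec c∈ | permChildren-insert _ spec′ c′∈
  ... | u , w , refl , refl | u′ , w′ , refl , x′≡ with insert-injective (suc (suc n)) u u′ (max∉ π refl) (max∉ π′ x′≡) c≡c′
  ...   | refl , refl = sym x′≡

permLevel-length : ∀ n → length (map proj₁ (permLevel n)) ≡ descendants n LA
permLevel-length n = trans (length-map proj₁ (permLevel n))
  (trans (length-grow (permLabel ∘ proj₂) (permChildren ∘ suc ∘ suc) (permChildren-label ∘ suc ∘ suc) _ n) (+-identityʳ _))

Inactive⇒¬Avoids : ∀ {m} u w → (∀ {a} → a ∈ u ++ w → a < m) → Inactive u w → ¬ Avoids PermPat (u ++ m ∷ w)
Inactive⇒¬Avoids u w <m (inj₁ (a , b , a∈ , b∈ , b<a)) (¬231 ∷ _) =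
  ¬231 (Occurs-120 b<a (<m (∈-++⁺ˡ a∈)) (++⁺ (from∈ a∈) (refl ∷ from∈ b∈)))
Inactive⇒¬Avoids u w <m (inj₂ (a , b , c , abc⊆ , a<b , b<c)) (_ ∷ ¬4123 ∷ _) =
  ¬4123 (Occurs-3012 a<b b<c (<m (∈-++⁺ʳ u (Sublist.lookup abc⊆ (there (there (here refl)))))) (++⁺ˡ u (refl ∷ abc⊆)))

remove-max : ∀ n u w → length (u ++ suc n ∷ w) ≡ suc n → (∀ k → 1 ≤ k → k ≤ suc n → k ∈ u ++ suc n ∷ w) →
  length (u ++ w) ≡ n × (∀ k → 1 ≤ k → k ≤ n → k ∈ u ++ w)
remove-max n u w len ∈y = suc-injective (trans (sym (length-++-sucʳ u (suc n) w)) len) , ∈x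
  where
  ∈x : ∀ k → 1 ≤ k → k ≤ n → k ∈ u ++ w
  ∈x k 1≤k k≤n with ∈-++⁻ u (∈y k 1≤k (m≤n⇒m≤1+n k≤n))
  ... | inj₁ k∈u = ∈-++⁺ˡ k∈u
  ... | inj₂ (here refl) = ⊥-elim (n≮n _ k≤n)
  ... | inj₂ (there k∈w) = ∈-++⁺ʳ u k∈w

permLevel-complete : ∀ n {y} → length y ≡ suc n → (∀ k → 1 ≤ k → k ≤ suc n → k ∈ y) → Avoids PermPat y →
  ∃ λ σ → (y , σ) ∈ permLevel n
permLevel-complete zero {y} len ∈y _ with y | len | ∈y 1 ≤-refl ≤-refl
... | _ ∷ [] | _ | here refl = pA [] [ 1 ] , here refl
permLevel-complete (suc n) {y} len ∈y av with ∈-∃++ (∈y (suc (suc n)) (s≤s z≤n) ≤-refl)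
... | u , w , refl with remove-max (suc n) u w len ∈y
...   | len′ , ∈x with permLevel-complete n len′ ∈x (Avoids-⊆ (⊆-insert u (suc (suc n)) w) av)
...     | σ , x∈ with permLevel-sound n x∈
...       | π , spec with permChildren-cut (suc (suc n)) u w refl spec
...         | inj₁ inactive = ⊥-elim (Inactive⇒¬Avoids u w (s≤s ∘ AvoidingPerm.≤n π) inactive av)
...         | inj₂ (c , c∈ , c≡) =
  proj₂ c , subst (λ z → (z , proj₂ c) ∈ permLevel (suc n)) c≡
    (∈-grow-suc (permLabel ∘ proj₂) (permChildren ∘ suc ∘ suc) (permChildren-label ∘ suc ∘ suc) {n = n} x∈ c∈)

permAvoid-card : ∀ n → HasCard (PermAvoid PermPat (suc n)) (descendants n LA)
permAvoid-card n = subst (λ k → PermAvoid PermPat (suc n) ↔ Fin k) (permLevel-length n)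
  (enumeration _ (map proj₁ (permLevel n)) (permLevel-unique n) complete sound)
  where
  complete : ∀ {y} → T (isPerm (suc n) y ∧ avoidsAll PermPat y) → y ∈ map proj₁ (permLevel n)
  complete {y} t with T-∧⁻ {isPerm (suc n) y} t
  ... | perm , av with isPerm⁻ (suc n) y perm
  ...   | len , ∈y = ∈-map⁺ proj₁ (proj₂ (permLevel-complete n len ∈y (avoidsAll⇒Avoids PermPat y av)))
  sound : ∀ {y} → y ∈ map proj₁ (permLevel n) → T (isPerm (suc n) y ∧ avoidsAll PermPat y)
  sound y∈ with ∈-map⁻ proj₁ y∈
  ... | e , e∈ , refl with permLevel-sound n e∈
  ...   | π , _ = T-∧⁺ {isPerm (suc n) (proj₁ e)} (isPerm⁺ (suc n) _ (AvoidingPerm.length≡n π) (AvoidingPerm.∈x π))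
                    (Avoids⇒avoidsAll PermPat _ (AvoidingPerm.avoids π))

-- The generating function

∑ : ℕ → (ℕ → ℤ) → ℤ
∑ n g = foldr ℤ._+_ (+ 0) (applyUpTo g n)

*ₛ-as-∑ : ∀ f g n → (f *ₛ g) n ≡ ∑ (suc n) (λ k → f k ℤ.* g (n ∸ k))
*ₛ-as-∑ f g n = cong (foldr ℤ._+_ (+ 0)) (map-applyUpTo (λ k → f k ℤ.* g (n ∸ k)) (λ k → k) (suc n))
  where
  map-applyUpTo : ∀ (h : ℕ → ℤ) (f : ℕ → ℕ) n → map h (applyUpTo f n) ≡ applyUpTo (h ∘ f) n
  map-applyUpTo h f zero = refl
  map-applyUpTo h f (suc n) = cong (h (f 0) ∷_) (map-applyUpTo h (f ∘ suc) n)

∑-zero : ∀ g n → (∀ i → i < n → g i ≡ + 0) → ∑ n g ≡ + 0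
∑-zero g zero _ = refl
∑-zero g (suc n) g≡0 rewrite g≡0 0 (s≤s z≤n) =
  trans (ℤ.+-identityˡ _) (∑-zero (g ∘ suc) n (λ i i<n → g≡0 (suc i) (s≤s i<n)))

∑-suc : ∀ g n → ∑ (suc n) g ≡ ∑ n g ℤ.+ g n
∑-suc g zero = trans (ℤ.+-identityʳ (g 0)) (sym (ℤ.+-identityˡ (g 0)))
∑-suc g (suc n) = trans (cong (λ t → g 0 ℤ.+ t) (∑-suc (g ∘ suc) n)) (sym (ℤ.+-assoc (g 0) (∑ n (g ∘ suc)) (g (suc n))))

VanishesAbove : ℕ → Series → Set
VanishesAbove d f = ∀ i → d < i → f i ≡ + 0

*ₛ-vanishesAbove : ∀ {f g} d₁ d₂ → VanishesAbove d₁ f → VanishesAbove d₂ g → VanishesAbove (d₁ + d₂) (f *ₛ g)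
*ₛ-vanishesAbove {f} {g} d₁ d₂ f≡0 g≡0 n d₁+d₂<n = trans (*ₛ-as-∑ f g n) (∑-zero _ (suc n) term≡0)
  where
  d₂<n∸i : ∀ {i} → i ≤ d₁ → d₂ < n ∸ i
  d₂<n∸i i≤d₁ = m+n≤o⇒m≤o∸n (suc d₂)
    (≤-trans (+-monoʳ-≤ (suc d₂) i≤d₁) (subst (_≤ n) (cong suc (+-comm d₁ d₂)) d₁+d₂<n))
  term≡0 : ∀ i → i < suc n → f i ℤ.* g (n ∸ i) ≡ + 0
  term≡0 i _ with i ≤? d₁
  ... | no i≰d₁ rewrite f≡0 i (≰⇒> i≰d₁) = refl
  ... | yes i≤d₁ rewrite g≡0 (n ∸ i) (d₂<n∸i i≤d₁) = ℤ.*-zeroʳ (f i)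

numerator-vanishesAbove : VanishesAbove 3 numerator
numerator-vanishesAbove = *ₛ-vanishesAbove 2 1 (*ₛ-vanishesAbove 1 1 1-x≡0 1-x≡0) 1-x≡0
  where
  1-x≡0 : VanishesAbove 1 oneMinusX
  1-x≡0 (suc (suc i)) _ = refl
  1-x≡0 1 (s≤s ())

*ₛ-denominator-tail : ∀ a j → (series a *ₛ denominator) (4 + j)
  ≡ + (a (4 + j) + 5 * a (2 + j)) ℤ.- + (4 * a (3 + j) + 3 * a (1 + j))
*ₛ-denominator-tail a j = trans (*ₛ-as-∑ (series a) denominator (4 + j)) last-four-terms
  where
  h : ℕ → ℤ
  h i = series a i ℤ.* denominator ((4 + j) ∸ i)
  low≡0 : ∀ i → i < suc j → h i ≡ + 0
  low≡0 i (s≤s i≤j) rewrite +-∸-assoc 4 i≤j = ℤ.*-zeroʳ (series a i)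
  identity : ∀ (x₁ x₂ x₃ x₄ : ℤ) →
    ((((+ 0 ℤ.+ x₁ ℤ.* (ℤ.- + 3)) ℤ.+ x₂ ℤ.* + 5) ℤ.+ x₃ ℤ.* (ℤ.- + 4)) ℤ.+ x₄ ℤ.* + 1)
    ≡ (x₄ ℤ.+ + 5 ℤ.* x₂) ℤ.- (+ 4 ℤ.* x₃ ℤ.+ + 3 ℤ.* x₁)
  identity = ℤ-Solver.solve-∀
  to-ℕ : ∀ x₁ x₂ x₃ x₄ →
    (+ x₄ ℤ.+ + 5 ℤ.* + x₂) ℤ.- (+ 4 ℤ.* + x₃ ℤ.+ + 3 ℤ.* + x₁) ≡ + (x₄ + 5 * x₂) ℤ.- + (4 * x₃ + 3 * x₁)
  to-ℕ x₁ x₂ x₃ x₄ rewrite sym (ℤ.pos-* 5 x₂) | sym (ℤ.pos-* 4 x₃) | sym (ℤ.pos-* 3 x₁)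
                         | sym (ℤ.pos-+ x₄ (5 * x₂)) | sym (ℤ.pos-+ (4 * x₃) (3 * x₁)) = refl
  last-four-terms : ∑ (5 + j) h ≡ + (a (4 + j) + 5 * a (2 + j)) ℤ.- + (4 * a (3 + j) + 3 * a (1 + j))
  last-four-terms
    rewrite ∑-suc h (4 + j) | ∑-suc h (3 + j) | ∑-suc h (2 + j) | ∑-suc h (1 + j) | ∑-zero h (suc j) low≡0
          | m+n∸n≡m 3 j | m+n∸n≡m 2 j | m+n∸n≡m 1 j | n∸n≡0 j
    = trans (identity (+ a (1 + j)) (+ a (2 + j)) (+ a (3 + j)) (+ a (4 + j)))
            (to-ℕ (a (1 + j)) (a (2 + j)) (a (3 + j)) (a (4 + j)))

count : ℕ → ℕ
count zero = 1
count (suc n) = descendants n LA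

count-series : ∀ k → (series count *ₛ denominator) k ≡ numerator k
count-series 0 = refl
count-series 1 = refl
count-series 2 = refl
count-series 3 = refl
count-series (suc (suc (suc (suc j)))) = begin
  (series count *ₛ denominator) (4 + j)
    ≡⟨ *ₛ-denominator-tail count j ⟩
  + (count (4 + j) + 5 * count (2 + j)) ℤ.- + (4 * count (3 + j) + 3 * count (1 + j))
    ≡⟨ cong (λ m → + m ℤ.- + (4 * count (3 + j) + 3 * count (1 + j))) (descendants-rec j) ⟩
  + (4 * count (3 + j) + 3 * count (1 + j)) ℤ.- + (4 * count (3 + j) + 3 * count (1 + j))
    ≡⟨ ℤ.+-inverseʳ (+ (4 * count (3 + j) + 3 * count (1 + j))) ⟩
  + 0
    ≡⟨ sym (numerator-vanishesAbove (4 + j) (s≤s (s≤s (s≤s (s≤s z≤n))))) ⟩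
  numerator (4 + j) ∎
  where open ≡-Reasoning

theorem3p4 : Σ (ℕ → ℕ) λ a →
    (a 0 ≡ 1)
  × ((n : ℕ) → 1 ≤ n →
        HasCard (AscAvoid ((0 ∷ 1 ∷ 0 ∷ 1 ∷ []) ∷ (0 ∷ 1 ∷ 2 ∷ 0 ∷ []) ∷ []) n) (a n)
      × HasCard (AscAvoid ((1 ∷ 0 ∷ 1 ∷ []) ∷ (1 ∷ 2 ∷ 0 ∷ []) ∷ []) n) (a n)
      × HasCard (PermAvoid ((2 ∷ 3 ∷ 1 ∷ []) ∷ (4 ∷ 1 ∷ 2 ∷ 3 ∷ []) ∷ []) n) (a n))
  × ((k : ℕ) → (series a *ₛ denominator) k ≡ numerator k)
theorem3p4 = count , refl , cards , count-series
  where
  cards : (n : ℕ) → 1 ≤ n →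
      HasCard (AscAvoid Pat₄ n) (count n) × HasCard (AscAvoid Pat₃ n) (count n) × HasCard (PermAvoid PermPat n) (count n)
  cards (suc n) _ = ascAvoid₄-card n , ascAvoid₃-card n , permAvoid-card n
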